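{- Let $f$ be a manageable width function. Let $H$ be a hypergraph, $(Red,X,Blue)$ a partition of $V(H)$ with no edge containing both a red and a blue vertex, and $F$ a reduced elimination forest of $H$. Let $U_0\subseteq Red\cup Blue$ be an $X$-homogenous context factor of $F$ with spine $P_0$, and let $P'_1,\dots,P'_q$ be the colour intervals of $P_0$ in order starting from the root of $U_0$. Suppose there is $1\le i\le q-3$ such that $(\mathrm{fw}_F(P'_i),\mathrm{fw}_F(P'_{i+1}),\mathrm{fw}_F(P'_{i+2}),\mathrm{fw}_F(P'_{i+3}))$ is mutable, i.e. $\mathrm{fw}_F(P'_{i+2})\ge \mathrm{fw}_F(P'_i)$ and $\mathrm{fw}_F(P'_{i+1})\ge\mathrm{fw}_F(P'_{i+3})$. Then the swap of $P'_{i+1}$ and $P'_{i+2}$ is neutral.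
   Context: Hypergraph: finite vertex set, edges non-empty subsets; vertices adjacent if some edge contains both; $H[U]$ has vertex set $U$, edges $\{e\cap U\ne\emptyset\}$; disjoint sets non-adjacent if no edge meets both. Manageable $f$: additive on disjoint non-adjacent sets; computable $\beta$ with $f_H(U)\le k\Rightarrow|U|\le\beta(k,\mathrm{rank}(H))$ ($\mathrm{rank}$ = max edge size); $H_1[U_1]\cong H_2[U_2]\Rightarrow f_{H_1}(U_1)=f_{H_2}(U_2)$; $f_H(V(H))$ computable in time bounded by a function of $|V(H)|$. Elimination forest $F$: rooted forest on $V(H)$, vertices of a common edge in ancestor–descendant relation; $F_u$ = descendants of $u$; $\mathrm{bag}_F(u)$ = $u$ plus ancestors adjacent to $u$ or a descendant of $u$; $f\text{ -width}(F)=\max_u f_H(\mathrm{bag}_F(u))$; reduced if each non-leaf $u$ is adjacent to some vertex of $F_v$ for each child $v$. Context factor: $F_x\setminus B$, $B$ a non-empty union of $F_y$ over sibling strict descendants $y$ of $x$; spine: path from $x$ to the parent of the $y$'s. Colour interval: maximal subpath of the spine inside $Red$ or inside $Blue$. Components of $H[\mathrm{bag}_F(u)]$ meeting $X$ form the $X$-ball; $U_0$ is $X$-homogenous if all spine vertices have the same $X$-ball. A component of $H[\mathrm{bag}_F(u)]$ disjoint from $X$ of colour different from $u$ is foreign; $\mathrm{fball}_F(u)$ is their union, and for a colour interval $P'$ of $P_0$, $\mathrm{fw}_F(P')=f_H(\mathrm{fball}_F(u))$ for any $u\in V(P')$ (this is independent of $u$). Swap of $P'_{i+1},P'_{i+2}$: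 with $F$-edges $(u_1,u_2)$ from the last vertex of $P'_i$ to the first of $P'_{i+1}$, $(v_1,v_2)$ from the last of $P'_{i+1}$ to the first of $P'_{i+2}$, $(w_1,w_2)$ from the last of $P'_{i+2}$ to the first of $P'_{i+3}$, remove these and add parent–child edges $(u_1,v_2),(w_1,u_2),(v_1,w_2)$, obtaining $F'$; the swap is neutral if $f\text{ -width}(F')\le f\text{ -width}(F)$.
   Formalization: The width function f takes values in ℚ rather than in the non-negative reals. -}

module Defs where

open import Data.Nat using (ℕ; zero; suc; _⊔_) renaming (_≤_ to _≤ℕ_)
open import Data.Rational using (ℚ; _+_; _≤_)
open import Data.Fin using (Fin; _≟_)
open import Data.Fin.Subset using (Subset; _∈_; _∉_; _∩_; _∪_; ∣_∣; Nonempty)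
open import Data.List using (List; []; _∷_; foldr; map; concat; _++_)
open import Data.List.NonEmpty using (List⁺; toList; last) renaming (head to head⁺)
open import Data.List.Relation.Unary.All using (All)
open import Data.List.Relation.Unary.Any using (Any)
open import Data.List.Relation.Unary.Linked using (Linked)
open import Data.Maybe using (Maybe; just; nothing)
open import Data.Product using (Σ; ∃; ∃-syntax; _×_; _,_; proj₁)
open import Data.Sum using (_⊎_)
open import Data.Empty using (⊥)
open import Relation.Nullary using (¬_; yes; no)
open import Relation.Binary.PropositionalEquality using (_≡_; _≢_)
open import Function.Bundles using (_⇔_)

record Hypergraph : Set where
  field
    n        : ℕ
    edges    : List (Subset n)
    nonempty : All Nonempty edges

open Hypergraph public

rank : Hypergraph → ℕ
rank H = foldr (λ e m → ∣ e ∣ ⊔ m) 0 (edges H)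

Adj : (H : Hypergraph) → Fin (n H) → Fin (n H) → Set
Adj H u v = Any (λ e → u ∈ e × v ∈ e) (edges H)

Disjoint : ∀ {m} → Subset m → Subset m → Set
Disjoint U W = ∀ x → x ∈ U → x ∉ W

NonAdjacentSets : (H : Hypergraph) → Subset (n H) → Subset (n H) → Set
NonAdjacentSets H U W =
  All (λ e → ∀ x y → x ∈ e → x ∈ U → y ∈ e → y ∈ W → ⊥) (edges H)

Elem : ∀ {m} → Subset m → Set
Elem {m} U = Σ (Fin m) (λ x → x ∈ U)

-- H₁[U₁] ≅ H₂[U₂]: a bijection U₁ ↔ U₂ mapping the edge set
-- {e ∩ U₁ ≠ ∅} of H₁[U₁] onto the edge set {e ∩ U₂ ≠ ∅} of H₂[U₂].
InducedIso : (H₁ : Hypergraph) → Subset (n H₁) → (H₂ : Hypergraph) → Subset (n H₂) → Set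
InducedIso H₁ U₁ H₂ U₂ =
  Σ (Elem U₁ → Elem U₂) λ g →
  Σ (Elem U₂ → Elem U₁) λ h →
    (∀ a → proj₁ (h (g a)) ≡ proj₁ a)
  × (∀ b → proj₁ (g (h b)) ≡ proj₁ b)
  × All (λ e → Nonempty (e ∩ U₁) →
           Any (λ e′ → ∀ a → (proj₁ a ∈ e ⇔ proj₁ (g a) ∈ e′)) (edges H₂)) (edges H₁)
  × All (λ e′ → Nonempty (e′ ∩ U₂) →
           Any (λ e → ∀ b → (proj₁ b ∈ e′ ⇔ proj₁ (h b) ∈ e)) (edges H₁)) (edges H₂)

WidthFn : Set
WidthFn = (H : Hypergraph) → Subset (n H) → ℚ

record Manageable (f : WidthFn) : Set where
  field
    additive  : ∀ H (U W : Subset (n H)) → Disjoint U W → NonAdjacentSets H U W →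
                f H (U ∪ W) ≡ f H U + f H W
    β         : ℚ → ℕ → ℕ
    bounded   : ∀ H (U : Subset (n H)) (k : ℚ) → f H U ≤ k → ∣ U ∣ ≤ℕ β k (rank H)
    iso-inv   : ∀ H₁ (U₁ : Subset (n H₁)) H₂ (U₂ : Subset (n H₂)) →
                InducedIso H₁ U₁ H₂ U₂ → f H₁ U₁ ≡ f H₂ U₂

Parent : ℕ → Set
Parent m = Fin m → Maybe (Fin m)

data StrictAnc {m} (par : Parent m) : Fin m → Fin m → Set where
  here  : ∀ {a v} → par v ≡ just a → StrictAnc par a v
  there : ∀ {a b v} → par v ≡ just b → StrictAnc par a b → StrictAnc par a v

Desc : ∀ {m} → Parent m → Fin m → Fin m → Set
Desc par u w = w ≡ u ⊎ StrictAnc par u w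

Acyclic : ∀ {m} → Parent m → Set
Acyclic par = ∀ v → ¬ StrictAnc par v v

Comparable : ∀ {m} → Parent m → Fin m → Fin m → Set
Comparable par u v = u ≡ v ⊎ (StrictAnc par u v ⊎ StrictAnc par v u)

record EliminationForest (H : Hypergraph) (par : Parent (n H)) : Set where
  field
    acyclic    : Acyclic par
    edges-comp : All (λ e → ∀ u v → u ∈ e → v ∈ e → Comparable par u v) (edges H)

Reduced : (H : Hypergraph) → Parent (n H) → Set
Reduced H par = ∀ u v → par v ≡ just u → ∃[ w ] (Desc par v w × Adj H u w)

InBag : (H : Hypergraph) → Parent (n H) → Fin (n H) → Fin (n H) → Set
InBag H par u w = w ≡ u ⊎ (StrictAnc par w u × ∃[ z ] (Desc par u z × Adj H w z))

_≐_ : ∀ {m} → Subset m → (Fin m → Set) → Set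
S ≐ P = ∀ x → (x ∈ S ⇔ P x)

-- f-width(F′) ≤ f-width(F)  (f-width = max over vertices of f(bag))
WidthLe : WidthFn → (H : Hypergraph) → Parent (n H) → Parent (n H) → Set
WidthLe f H par′ par =
  ∀ u′ (B′ : Subset (n H)) → B′ ≐ InBag H par′ u′ →
  ∃[ u ] ∃[ B ] (B ≐ InBag H par u × f H B′ ≤ f H B)

data Colour : Set where
  red xcol blue : Colour

NoRedBlueEdge : (H : Hypergraph) → (Fin (n H) → Colour) → Set
NoRedBlueEdge H col =
  All (λ e → ∀ u v → u ∈ e → v ∈ e → col u ≡ red → col v ≢ blue) (edges H)

data Conn (H : Hypergraph) (B : Fin (n H) → Set) : Fin (n H) → Fin (n H) → Set where
  start : ∀ {x} → B x → Conn H B x x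
  step  : ∀ {x y z} → Conn H B x y → Adj H y z → B z → Conn H B x z

InXBall : (H : Hypergraph) → (Fin (n H) → Colour) → Parent (n H) → Fin (n H) → Fin (n H) → Set
InXBall H col par u w =
  ∃[ z ] (col z ≡ xcol × Conn H (InBag H par u) z w)

OtherColour : Colour → Colour → Set
OtherColour c d = (c ≡ red × d ≡ blue) ⊎ (c ≡ blue × d ≡ red)

InFBall : (H : Hypergraph) → (Fin (n H) → Colour) → Parent (n H) → Fin (n H) → Fin (n H) → Set
InFBall H col par u w =
  InBag H par u w
  × (∀ z → Conn H (InBag H par u) w z → col z ≢ xcol)
  × OtherColour (col u) (col w)

FW : WidthFn → (H : Hypergraph) → (Fin (n H) → Colour) → Parent (n H) → List⁺ (Fin (n H)) → ℚ → Set
FW f H col par P r = ∃[ S ] (S ≐ InFBall H col par (head⁺ P) × f H S ≡ r)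

data DownPath {m} (par : Parent m) : Fin m → Fin m → List (Fin m) → Set where
  single : ∀ {a} → DownPath par a a (a ∷ [])
  step   : ∀ {a b c l} → par b ≡ just a → DownPath par b c l → DownPath par a c (a ∷ l)

record ContextFactor {m} (par : Parent m) (U₀ : Subset m) (spine : List (Fin m)) : Set where
  field
    x p      : Fin m
    Y        : Subset m
    Y-ne     : Nonempty Y
    siblings : ∀ y → y ∈ Y → par y ≡ just p
    p-desc   : Desc par x p
    U₀-def   : U₀ ≐ (λ v → Desc par x v × ¬ (∃[ y ] (y ∈ Y × Desc par y v)))
    spine-path : DownPath par x p spine

-- Ps are the colour intervals of the spine, in order from the top:
-- non-empty monochromatic consecutive blocks covering the spine, with
-- consecutive blocks of different colours (hence maximal).
ColourIntervals : ∀ {m} → (Fin m → Colour) → List (Fin m) → List (List⁺ (Fin m)) → Set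
ColourIntervals col spine Ps =
    concat (map toList Ps) ≡ spine
  × All (λ P → All (λ v → col v ≡ col (head⁺ P)) (toList P)) Ps
  × Linked (λ P Q → col (head⁺ P) ≢ col (head⁺ Q)) Ps

XHomogenous : (H : Hypergraph) → (Fin (n H) → Colour) → Parent (n H) → List (Fin (n H)) → Set
XHomogenous H col par spine =
  All (λ u → All (λ v → ∀ w → (InXBall H col par u w ⇔ InXBall H col par v w)) spine) spine

swapParent : ∀ {m} → Parent m → (P₁ P₂ P₃ P₄ : List⁺ (Fin m)) → Parent m
swapParent par P₁ P₂ P₃ P₄ v with v ≟ head⁺ P₃
... | yes _ = just (last P₁)
... | no _ with v ≟ head⁺ P₂
...   | yes _ = just (last P₃)
...   | no _ with v ≟ head⁺ P₄
...     | yes _ = just (last P₂)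
...     | no _ = par v

Fin′ : Hypergraph → Set
Fin′ H = Fin (n H)

-- Swapping P₂ and P₃ only changes ancestry between the subtrees hanging below P₂ and
-- P₃, so bags of vertices off these two intervals are unchanged. Since the intervals
-- alternate in colour, their hanging subtrees are monochromatic, and X-balls are constant
-- along the spine, the new bag of a vertex z of P₃ (resp. P₂) is the disjoint union of
-- two non-adjacent parts: the non-foreign part of its old bag, and the foreign ball of
-- P₁ (resp. P₄); the old bag is that same part plus the foreign ball of P₃ (resp. P₂).
-- Additivity of f and mutability, fw(P₁) ≤ fw(P₃) and fw(P₄) ≤ fw(P₂), conclude.

module Submission where

open import Defs
open import Data.Nat as ℕ using (ℕ; zero; suc; _+_; _∸_)
import Data.Nat.Properties as ℕ
open import Data.Rational using (_≤_) renaming (_+_ to _+ℚ_)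
import Data.Rational.Properties as ℚ
open import Data.Fin using (Fin; toℕ; fromℕ<; _≟_)
import Data.Fin.Properties as Fin
open import Data.Fin.Subset using (Subset; _∈_; _-_; _∪_; ∣_∣)
open import Data.Fin.Subset.Properties
  using (_∈?_; ⊆-antisym; ∪⇔⊎; x∈p∧x≢y⇒x∈p-y; x∈p⇒∣p-x∣<∣p∣; p─q⊆p; p⊂q⇒∣p∣<∣q∣)
open import Data.Vec using (tabulate)
open import Data.Vec.Properties using (lookup∘tabulate; lookup⇒[]=; []=⇒lookup)
open import Data.List using (List; []; _∷_; _++_; concat; map; initLast; _∷ʳ′_)
import Data.List.Properties as List
open import Data.List.NonEmpty using (List⁺; toList; last) renaming (_∷_ to _∷⁺_; head to head⁺)
open import Data.List.Membership.Propositional using () renaming (_∈_ to _∈ˡ_)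
open import Data.List.Relation.Unary.All as All using (All; _∷_)
import Data.List.Relation.Unary.All.Properties as All
open import Data.List.Relation.Unary.Any as Any using (here; there)
open import Data.List.Relation.Unary.Linked as Linked using (Linked; _∷_)
open import Data.Maybe using (Maybe; just; nothing; _>>=_; fromMaybe)
open import Data.Maybe.Properties using (just-injective; ≡-dec)
open import Data.Product using (∃-syntax; _×_; _,_; proj₁; proj₂; map₁; uncurry)
open import Data.Sum using (_⊎_; inj₁; inj₂)
open import Data.Sum.Function.Propositional using (_⊎-⇔_)
open import Data.Empty using (⊥; ⊥-elim)
open import Function using (_∘_; id)
open import Function.Bundles using (_⇔_; mk⇔; Equivalence)
open import Function.Properties.Equivalence using () renaming (sym to ⇔-sym; trans to ⇔-trans; refl to ⇔-refl)
open import Relation.Nullary using (¬_; ¬?; Dec; yes; no; does; contradiction; _×-dec_)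
import Relation.Nullary.Decidable as Dec
open import Relation.Binary.PropositionalEquality

opposite : Colour → Colour
opposite red  = blue
opposite xcol = xcol
opposite blue = red

_≟ᶜ_ : (c d : Colour) → Dec (c ≡ d)
red  ≟ᶜ red  = yes refl
red  ≟ᶜ xcol = no λ ()
red  ≟ᶜ blue = no λ ()
xcol ≟ᶜ red  = no λ ()
xcol ≟ᶜ xcol = yes refl
xcol ≟ᶜ blue = no λ ()
blue ≟ᶜ red  = no λ ()
blue ≟ᶜ xcol = no λ ()
blue ≟ᶜ blue = yes refl

≢⇒≡opposite : ∀ {c d} → c ≢ xcol → d ≢ xcol → c ≢ d → d ≡ opposite c
≢⇒≡opposite {red}  {red}  _   _   c≢d = contradiction refl c≢d
≢⇒≡opposite {red}  {blue} _   _   _   = refl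
≢⇒≡opposite {blue} {red}  _   _   _   = refl
≢⇒≡opposite {blue} {blue} _   _   c≢d = contradiction refl c≢d
≢⇒≡opposite {xcol}        c≢x _   _   = contradiction refl c≢x
≢⇒≡opposite {red}  {xcol} _   d≢x _   = contradiction refl d≢x
≢⇒≡opposite {blue} {xcol} _   d≢x _   = contradiction refl d≢x

alternating : ∀ {c d e} → c ≢ xcol → d ≢ xcol → e ≢ xcol → c ≢ d → d ≢ e → c ≡ e
alternating c≢x d≢x e≢x c≢d d≢e =
  trans (≢⇒≡opposite d≢x c≢x (c≢d ∘ sym)) (sym (≢⇒≡opposite d≢x e≢x d≢e))

opposite-≢ : ∀ {c} → c ≢ xcol → opposite c ≢ c
opposite-≢ {red}  _   ()
opposite-≢ {blue} _   ()
opposite-≢ {xcol} c≢x _ = c≢x refl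

opposite-≢xcol : ∀ {c} → c ≢ xcol → opposite c ≢ xcol
opposite-≢xcol {red}  _   ()
opposite-≢xcol {blue} _   ()
opposite-≢xcol {xcol} c≢x _ = c≢x refl

OtherColour⇔ : ∀ {c d} → OtherColour c d ⇔ (c ≢ xcol × d ≡ opposite c)
OtherColour⇔ = mk⇔ to from
  where
  to : ∀ {c d} → OtherColour c d → c ≢ xcol × d ≡ opposite c
  to (inj₁ (refl , refl)) = (λ ()) , refl
  to (inj₂ (refl , refl)) = (λ ()) , refl
  from : ∀ {c d} → c ≢ xcol × d ≡ opposite c → OtherColour c d
  from {red}  (_ , refl)  = inj₁ (refl , refl)
  from {blue} (_ , refl)  = inj₂ (refl , refl)
  from {xcol} (c≢x , _)   = contradiction refl c≢x

OtherColour? : ∀ c d → Dec (OtherColour c d)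
OtherColour? c d = Dec.map (⇔-sym OtherColour⇔) (¬? (c ≟ᶜ xcol) ×-dec (d ≟ᶜ opposite c))

Linked-++⁻ʳ : ∀ {A : Set} {R : A → A → Set} xs {ys} → Linked R (xs ++ ys) → Linked R ys
Linked-++⁻ʳ []       rs = rs
Linked-++⁻ʳ (x ∷ xs) rs = Linked-++⁻ʳ xs (Linked.tail rs)

last-∷ : ∀ {A : Set} (h x : A) t → last (h ∷⁺ x ∷ t) ≡ last (x ∷⁺ t)
last-∷ h x t with initLast t
... | []       = refl
... | ys ∷ʳ′ y = refl

module Ancestry {m : ℕ} (par : Parent m) where

  infix 4 _⊏_ _⊑_

  _⊏_ _⊑_ : Fin m → Fin m → Set
  _⊏_ = StrictAnc par
  _⊑_ = Desc par

  ⊏-trans : ∀ {a b c} → a ⊏ b → b ⊏ c → a ⊏ c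
  ⊏-trans a⊏b (here e)      = there e a⊏b
  ⊏-trans a⊏b (there e b⊏c) = there e (⊏-trans a⊏b b⊏c)

  ⊑-⊏-trans : ∀ {a b c} → a ⊑ b → b ⊏ c → a ⊏ c
  ⊑-⊏-trans (inj₁ refl) b⊏c = b⊏c
  ⊑-⊏-trans (inj₂ a⊏b)  b⊏c = ⊏-trans a⊏b b⊏c

  ⊏-⊑-trans : ∀ {a b c} → a ⊏ b → b ⊑ c → a ⊏ c
  ⊏-⊑-trans a⊏b (inj₁ refl) = a⊏b
  ⊏-⊑-trans a⊏b (inj₂ b⊏c)  = ⊏-trans a⊏b b⊏c

  ⊑-trans : ∀ {a b c} → a ⊑ b → b ⊑ c → a ⊑ c
  ⊑-trans (inj₁ refl) b⊑c = b⊑c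
  ⊑-trans (inj₂ a⊏b)  b⊑c = inj₂ (⊏-⊑-trans a⊏b b⊑c)

module Forest {m : ℕ} (par : Parent m) (acyclic : Acyclic par) where

  open Ancestry par public

  ⊏-irrefl : ∀ {a b} → a ⊏ b → a ≢ b
  ⊏-irrefl a⊏a refl = acyclic _ a⊏a

  ⊑⇒¬⊐ : ∀ {a b} → a ⊑ b → ¬ b ⊏ a
  ⊑⇒¬⊐ a⊑b b⊏a = acyclic _ (⊏-⊑-trans b⊏a a⊑b)

  ⊑-antisym : ∀ {a b} → a ⊑ b → b ⊑ a → a ≡ b
  ⊑-antisym (inj₁ refl) _   = refl
  ⊑-antisym (inj₂ a⊏b)  b⊑a = contradiction a⊏b (⊑⇒¬⊐ b⊑a)

  ⊏-parent : ∀ {a v p} → par v ≡ just p → a ⊏ v → a ⊑ p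
  ⊏-parent e (here e′)       = inj₁ (just-injective (trans (sym e) e′))
  ⊏-parent e (there e′ a⊏b) with just-injective (trans (sym e′) e)
  ... | refl = inj₂ a⊏b

  ⊑-parent : ∀ {a z b} → par z ≡ just b → a ⊑ z → z ≢ a → a ⊑ b
  ⊑-parent e (inj₁ z≡a) z≢a = contradiction z≡a z≢a
  ⊑-parent e (inj₂ a⊏z) _   = ⊏-parent e a⊏z

  ⊏-linear : ∀ {a b v} → a ⊏ v → b ⊏ v → a ≡ b ⊎ a ⊏ b ⊎ b ⊏ a
  ⊏-linear (here e₁) (here e₂) = inj₁ (just-injective (trans (sym e₁) e₂))
  ⊏-linear (here e₁) (there e₂ b⊏c) with just-injective (trans (sym e₁) e₂)
  ... | refl = inj₂ (inj₂ b⊏c)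
  ⊏-linear (there e₁ a⊏c) (here e₂) with just-injective (trans (sym e₁) e₂)
  ... | refl = inj₂ (inj₁ a⊏c)
  ⊏-linear (there e₁ a⊏c) (there e₂ b⊏c) with just-injective (trans (sym e₁) e₂)
  ... | refl = ⊏-linear a⊏c b⊏c

  ⊑-linear : ∀ {a b v} → a ⊑ v → b ⊑ v → a ⊑ b ⊎ b ⊏ a
  ⊑-linear (inj₁ refl) (inj₁ refl) = inj₁ (inj₁ refl)
  ⊑-linear (inj₁ refl) (inj₂ b⊏a)  = inj₂ b⊏a
  ⊑-linear (inj₂ a⊏b)  (inj₁ refl) = inj₁ (inj₂ a⊏b)
  ⊑-linear (inj₂ a⊏v)  (inj₂ b⊏v)  with ⊏-linear a⊏v b⊏v
  ... | inj₁ refl        = inj₁ (inj₁ refl)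
  ... | inj₂ (inj₁ a⊏b)  = inj₁ (inj₂ a⊏b)
  ... | inj₂ (inj₂ b⊏a)  = inj₂ b⊏a

  ⊏⇒child : ∀ {z y} → z ⊏ y → ∃[ r ] (par r ≡ just z × r ⊑ y)
  ⊏⇒child (here e)      = _ , e , inj₁ refl
  ⊏⇒child (there e z⊏b) with ⊏⇒child z⊏b
  ... | r , pr , r⊑b = r , pr , ⊑-trans r⊑b (inj₂ (here e))

  downPath-head : ∀ {a b c l} → DownPath par a b (c ∷ l) → a ≡ c
  downPath-head single     = refl
  downPath-head (step _ _) = refl

  downPath-⊑ : ∀ {a b l} → DownPath par a b l → a ⊑ b
  downPath-⊑ single     = inj₁ refl
  downPath-⊑ (step e p) = inj₂ (⊏-⊑-trans (here e) (downPath-⊑ p))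

  ∈-downPath : ∀ {a b l s} → DownPath par a b l → a ⊑ s → s ⊑ b → s ∈ˡ l
  ∈-downPath single a⊑s s⊑b with ⊑-antisym a⊑s s⊑b
  ... | refl = here refl
  ∈-downPath (step e p) (inj₁ refl) s⊑b = here refl
  ∈-downPath (step e p) (inj₂ a⊏s)  s⊑b with ⊑-linear s⊑b (downPath-⊑ p)
  ... | inj₂ c⊏s = there (∈-downPath p (inj₂ c⊏s) s⊑b)
  ... | inj₁ (inj₁ refl) = there (∈-downPath p (inj₁ refl) s⊑b)
  ... | inj₁ (inj₂ s⊏c) with ⊏-parent e s⊏c
  ...   | inj₁ refl = here refl
  ...   | inj₂ s⊏a  = contradiction a⊏s (⊑⇒¬⊐ (inj₂ s⊏a))

  downPath-++⁻ʳ : ∀ {a b c} l₁ {l₂} → DownPath par a b (l₁ ++ c ∷ l₂) →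
                  a ⊑ c × DownPath par c b (c ∷ l₂)
  downPath-++⁻ʳ [] p with downPath-head p
  ... | refl = inj₁ refl , p
  downPath-++⁻ʳ (_ ∷ [])     (step e p) = map₁ (⊑-trans (inj₂ (here e))) (downPath-++⁻ʳ [] p)
  downPath-++⁻ʳ (_ ∷ y ∷ l₁) (step e p) = map₁ (⊑-trans (inj₂ (here e))) (downPath-++⁻ʳ (y ∷ l₁) p)

  downPath-split : ∀ {a b c l} (P : List⁺ (Fin m)) → DownPath par a b (toList P ++ c ∷ l) →
                   DownPath par a (last P) (toList P) × par c ≡ just (last P) × DownPath par c b (c ∷ l)
  downPath-split (h ∷⁺ [])    (step e p) with downPath-head p
  ... | refl = single , e , p
  downPath-split (h ∷⁺ x ∷ t) (step e p) with downPath-head p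
  ... | refl rewrite last-∷ h x t with downPath-split (x ∷⁺ t) p
  ...   | q , e′ , r = step e q , e′ , r

  ancestor : ℕ → Fin m → Maybe (Fin m)
  ancestor zero    v = just v
  ancestor (suc k) v = par v >>= ancestor k

  ancestor-+ : ∀ i d v → ancestor (i + d) v ≡ (ancestor i v >>= ancestor d)
  ancestor-+ zero    d v = refl
  ancestor-+ (suc i) d v with par v
  ... | nothing = refl
  ... | just b  = ancestor-+ i d b

  ancestor-suc⇒⊏ : ∀ k {a v} → ancestor (suc k) v ≡ just a → a ⊏ v
  ancestor-suc⇒⊏ zero    {v = v} e with par v in pv
  ancestor-suc⇒⊏ zero    refl | just b = here pv
  ancestor-suc⇒⊏ (suc k) {v = v} e with par v in pv
  ... | just b = there pv (ancestor-suc⇒⊏ k e)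

  ⊏⇒ancestor-suc : ∀ {a v} → a ⊏ v → ∃[ k ] ancestor (suc k) v ≡ just a
  ⊏⇒ancestor-suc (here e)      rewrite e = 0 , refl
  ⊏⇒ancestor-suc (there e a⊏b) with ⊏⇒ancestor-suc a⊏b
  ... | k , up≡ rewrite e = suc k , up≡

  ancestor-mono-nothing : ∀ {i j v} → i ℕ.≤ j → ancestor i v ≡ nothing → ancestor j v ≡ nothing
  ancestor-mono-nothing {i} {j} {v} i≤j up≡ = begin
    ancestor j v                        ≡⟨ cong (λ k → ancestor k v) (ℕ.m+[n∸m]≡n i≤j) ⟨
    ancestor (i + (j ∸ i)) v            ≡⟨ ancestor-+ i (j ∸ i) v ⟩
    (ancestor i v >>= ancestor (j ∸ i)) ≡⟨ cong (_>>= ancestor (j ∸ i)) up≡ ⟩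
    nothing                             ∎
    where open ≡-Reasoning

  ancestor-repeat⇒⊥ : ∀ {i j v b} → i ℕ.< j → ancestor i v ≡ just b → ancestor j v ≡ just b → ⊥
  ancestor-repeat⇒⊥ {i} {j} {v} {b} i<j upᵢ upⱼ = acyclic b (ancestor-suc⇒⊏ d cycle)
    where
    open ≡-Reasoning
    d : ℕ
    d = j ∸ suc i
    cycle : ancestor (suc d) b ≡ just b
    cycle = begin
      ancestor (suc d) b                  ≡⟨ cong (_>>= ancestor (suc d)) upᵢ ⟨
      (ancestor i v >>= ancestor (suc d)) ≡⟨ ancestor-+ i (suc d) v ⟨
      ancestor (i + suc d) v              ≡⟨ cong (λ k → ancestor k v) (ℕ.+-suc i d) ⟩
      ancestor (suc i + d) v              ≡⟨ cong (λ k → ancestor k v) (ℕ.m+[n∸m]≡n i<j) ⟩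
      ancestor j v                        ≡⟨ upⱼ ⟩
      just b                              ∎

  -- by pigeonhole, m + 1 successive ancestors cannot all exist
  ancestor-suc⇒< : ∀ k {a v} → ancestor (suc k) v ≡ just a → k ℕ.< m
  ancestor-suc⇒< k {a} {v} up≡ with k ℕ.<? m
  ... | yes k<m = k<m
  ... | no  k≮m = ⊥-elim repeat
    where
    g : Fin (suc m) → Fin m
    g i = fromMaybe a (ancestor (toℕ i) v)
    g-spec : ∀ i → ancestor (toℕ i) v ≡ just (g i)
    g-spec i with ancestor (toℕ i) v in up≡ᵢ
    ... | just _  = refl
    ... | nothing = contradiction (trans (sym (ancestor-mono-nothing i≤1+k up≡ᵢ)) up≡) λ ()
      where
      i≤1+k : toℕ i ℕ.≤ suc k
      i≤1+k = ℕ.m≤n⇒m≤1+n (ℕ.≤-trans (ℕ.s≤s⁻¹ (Fin.toℕ<n i)) (ℕ.≮⇒≥ k≮m))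
    repeat : ⊥
    repeat with Fin.pigeonhole (ℕ.n<1+n m) g
    ... | i , j , i<j , gᵢ≡gⱼ = ancestor-repeat⇒⊥ i<j (g-spec i) (trans (g-spec j) (cong just (sym gᵢ≡gⱼ)))

  _⊏?_ : ∀ a v → Dec (a ⊏ v)
  a ⊏? v = Dec.map′ to from (Fin.any? λ k → ≡-dec _≟_ (ancestor (suc (toℕ k)) v) (just a))
    where
    to : ∃[ k ] ancestor (suc (toℕ k)) v ≡ just a → a ⊏ v
    to (k , up≡) = ancestor-suc⇒⊏ (toℕ k) up≡
    from : a ⊏ v → ∃[ k ] ancestor (suc (toℕ k)) v ≡ just a
    from a⊏v with ⊏⇒ancestor-suc a⊏v
    ... | k , up≡ = fromℕ< k<m , subst (λ i → ancestor (suc i) v ≡ just a) (sym (Fin.toℕ-fromℕ< k<m)) up≡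
      where
      k<m : k ℕ.< m
      k<m = ancestor-suc⇒< k up≡

  _⊑?_ : ∀ a v → Dec (a ⊑ v)
  a ⊑? v = (v ≟ a) Dec.⊎-dec (a ⊏? v)

module _ {k : ℕ} {P : Fin k → Set} (P? : ∀ x → Dec (P x)) where

  subsetOf : Subset k
  subsetOf = tabulate (does ∘ P?)

  subsetOf≐ : subsetOf ≐ P
  subsetOf≐ x = mk⇔ to from
    where
    to : x ∈ subsetOf → P x
    to x∈ with P? x | trans (sym (lookup∘tabulate (does ∘ P?) x)) ([]=⇒lookup x∈)
    ... | yes px | _ = px
    from : P x → x ∈ subsetOf
    from px with P? x in P?x
    ... | yes _  = lookup⇒[]= x subsetOf (trans (lookup∘tabulate (does ∘ P?) x) (cong does P?x))
    ... | no ¬px = contradiction px ¬px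

module Additivity {f : WidthFn} (M : Manageable f) (H : Hypergraph) where

  ≐-additive : ∀ (S U W : Subset (n H)) → S ≐ (λ x → x ∈ U ⊎ x ∈ W) →
               Disjoint U W → NonAdjacentSets H U W → f H S ≡ f H U +ℚ f H W
  ≐-additive S U W S≐ disjoint nonAdjacent = trans (cong (f H) S≡U∪W) (Manageable.additive M H U W disjoint nonAdjacent)
    where
    S≡U∪W : S ≡ U ∪ W
    S≡U∪W = ⊆-antisym (Equivalence.from ∪⇔⊎ ∘ Equivalence.to (S≐ _))
                      (Equivalence.from (S≐ _) ∘ Equivalence.to ∪⇔⊎)

module Connectivity (H : Hypergraph) where

  Adj-sym : ∀ {u v} → Adj H u v → Adj H v u
  Adj-sym = Any.map (λ (u∈e , v∈e) → v∈e , u∈e)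

  Adj? : ∀ u v → Dec (Adj H u v)
  Adj? u v = Any.any? (λ e → (u ∈? e) ×-dec (v ∈? e)) (edges H)

  module _ {B : Fin (n H) → Set} where

    Conn-source : ∀ {x w} → Conn H B x w → B x
    Conn-source (start b)    = b
    Conn-source (step c _ _) = Conn-source c

    Conn-target : ∀ {x w} → Conn H B x w → B w
    Conn-target (start b)    = b
    Conn-target (step _ _ b) = b

    Conn-trans : ∀ {x y w} → Conn H B x y → Conn H B y w → Conn H B x w
    Conn-trans c (start _)    = c
    Conn-trans c (step d a b) = step (Conn-trans c d) a b

    Conn-cons : ∀ {x y w} → B x → Adj H x y → Conn H B y w → Conn H B x w
    Conn-cons bx a c = Conn-trans (step (start bx) a (Conn-source c)) c

    Conn-sym : ∀ {x w} → Conn H B x w → Conn H B w x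
    Conn-sym (start b)    = start b
    Conn-sym (step c a b) = Conn-cons b (Adj-sym a) (Conn-sym c)

  Conn-mono : ∀ {B B′ : Fin (n H) → Set} {x w} → (∀ {v} → B v → B′ v) → Conn H B x w → Conn H B′ x w
  Conn-mono B⊆B′ (start b)    = start (B⊆B′ b)
  Conn-mono B⊆B′ (step c a b) = step (Conn-mono B⊆B′ c) a (B⊆B′ b)

  private
    Connˢ : Subset (n H) → Fin (n H) → Fin (n H) → Set
    Connˢ S = Conn H (_∈ S)

    Connˢ-uncons : ∀ {S x w} → Connˢ S x w → x ≢ w → ∃[ y ] (Adj H x y × y ∈ S × Connˢ (S - x) y w)
    Connˢ-uncons (start _) x≢w = contradiction refl x≢w
    Connˢ-uncons {S} {x} (step {y = y′} c a w∈S) x≢w with y′ ≟ x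
    ... | yes refl = _ , a , w∈S , start (x∈p∧x≢y⇒x∈p-y w∈S (x≢w ∘ sym))
    ... | no y′≢x with Connˢ-uncons c (y′≢x ∘ sym)
    ...   | y , a′ , y∈S , c′ = y , a′ , y∈S , step c′ a (x∈p∧x≢y⇒x∈p-y w∈S (x≢w ∘ sym))

    Connˢ? : ∀ fuel (S : Subset (n H)) → ∣ S ∣ ℕ.< fuel → ∀ x w → Dec (Connˢ S x w)
    Connˢ? (suc fuel) S ∣S∣<fuel x w with x ∈? S
    ... | no x∉S = no (x∉S ∘ Conn-source)
    ... | yes x∈S with x ≟ w
    ...   | yes refl = yes (start x∈S)
    ...   | no x≢w = Dec.map′ (λ (y , a , _ , c) → Conn-cons x∈S a (Conn-mono (p─q⊆p S _) c))
                              (λ c → Connˢ-uncons c x≢w)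
                              (Fin.any? λ y → Adj? x y ×-dec (y ∈? S) ×-dec Connˢ? fuel (S - x) smaller y w)
      where
      smaller : ∣ S - x ∣ ℕ.< fuel
      smaller = ℕ.<-≤-trans (x∈p⇒∣p-x∣<∣p∣ x∈S) (ℕ.s≤s⁻¹ ∣S∣<fuel)

  Conn? : ∀ {B : Fin (n H) → Set} → (∀ v → Dec (B v)) → ∀ x w → Dec (Conn H B x w)
  Conn? B? x w = Dec.map′ (Conn-mono (Equivalence.to (subsetOf≐ B? _)))
                          (Conn-mono (Equivalence.from (subsetOf≐ B? _)))
                          (Connˢ? _ (subsetOf B?) (ℕ.n<1+n _) x w)

module Setting
  (H : Hypergraph) (col : Fin′ H → Colour) (noRedBlue : NoRedBlueEdge H col)
  (par : Parent (n H)) (EF : EliminationForest H par) (reduced : Reduced H par)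
  (U₀ : Subset (n H)) (spine : List (Fin′ H)) (CF : ContextFactor par U₀ spine)
  (U₀-noX : ∀ v → v ∈ U₀ → col v ≢ xcol) (XH : XHomogenous H col par spine)
  (Ps Al C : List (List⁺ (Fin′ H))) (CI : ColourIntervals col spine Ps)
  (P₁ P₂ P₃ P₄ : List⁺ (Fin′ H)) (Ps≡ : Ps ≡ Al ++ P₁ ∷ P₂ ∷ P₃ ∷ P₄ ∷ C)
  where

  open Forest par (EliminationForest.acyclic EF) public
  open Connectivity H public
  open ContextFactor CF

  V : Set
  V = Fin (n H)

  h₁ u₁ u₂ v₁ v₂ w₁ w₂ : V
  h₁ = head⁺ P₁
  u₁ = last P₁
  u₂ = head⁺ P₂
  v₁ = last P₂
  v₂ = head⁺ P₃
  w₁ = last P₃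
  w₂ = head⁺ P₄

  private
    Rest : List V
    Rest = concat (map toList C)

    spine≡ : spine ≡ concat (map toList Al) ++ toList P₁ ++ toList P₂ ++ toList P₃ ++ toList P₄ ++ Rest
    spine≡ = begin
      spine                                            ≡⟨ proj₁ CI ⟨
      concat (map toList Ps)                           ≡⟨ cong (concat ∘ map toList) Ps≡ ⟩
      concat (map toList (Al ++ P₁ ∷ P₂ ∷ P₃ ∷ P₄ ∷ C)) ≡⟨ List.concatMap-++ toList Al _ ⟩
      _                                                ∎
      where open ≡-Reasoning

    path-from-h₁ : x ⊑ h₁ × DownPath par h₁ p (toList P₁ ++ toList P₂ ++ toList P₃ ++ toList P₄ ++ Rest)
    path-from-h₁ = downPath-++⁻ʳ (concat (map toList Al)) (subst (DownPath par x p) spine≡ spine-path)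
    path-P₁ : DownPath par h₁ u₁ (toList P₁) × par u₂ ≡ just u₁ ×
              DownPath par u₂ p (toList P₂ ++ toList P₃ ++ toList P₄ ++ Rest)
    path-P₁ = downPath-split P₁ (proj₂ path-from-h₁)
    path-P₂ : DownPath par u₂ v₁ (toList P₂) × par v₂ ≡ just v₁ ×
              DownPath par v₂ p (toList P₃ ++ toList P₄ ++ Rest)
    path-P₂ = downPath-split P₂ (proj₂ (proj₂ path-P₁))
    path-P₃ : DownPath par v₂ w₁ (toList P₃) × par w₂ ≡ just w₁ × DownPath par w₂ p (toList P₄ ++ Rest)
    path-P₃ = downPath-split P₃ (proj₂ (proj₂ path-P₂))

  par-u₂ : par u₂ ≡ just u₁
  par-u₂ = proj₁ (proj₂ path-P₁)
  par-v₂ : par v₂ ≡ just v₁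
  par-v₂ = proj₁ (proj₂ path-P₂)
  par-w₂ : par w₂ ≡ just w₁
  par-w₂ = proj₁ (proj₂ path-P₃)

  x⊑h₁ : x ⊑ h₁
  x⊑h₁ = proj₁ path-from-h₁
  w₂⊑p : w₂ ⊑ p
  w₂⊑p = downPath-⊑ (proj₂ (proj₂ path-P₃))
  h₁⊑u₁ : h₁ ⊑ u₁
  h₁⊑u₁ = downPath-⊑ (proj₁ path-P₁)
  u₂⊑v₁ : u₂ ⊑ v₁
  u₂⊑v₁ = downPath-⊑ (proj₁ path-P₂)
  v₂⊑w₁ : v₂ ⊑ w₁
  v₂⊑w₁ = downPath-⊑ (proj₁ path-P₃)

  u₁⊏u₂ : u₁ ⊏ u₂
  u₁⊏u₂ = here par-u₂
  v₁⊏v₂ : v₁ ⊏ v₂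
  v₁⊏v₂ = here par-v₂
  w₁⊏w₂ : w₁ ⊏ w₂
  w₁⊏w₂ = here par-w₂
  u₂⊏v₂ : u₂ ⊏ v₂
  u₂⊏v₂ = ⊑-⊏-trans u₂⊑v₁ v₁⊏v₂
  v₂⊏w₂ : v₂ ⊏ w₂
  v₂⊏w₂ = ⊑-⊏-trans v₂⊑w₁ w₁⊏w₂
  u₂⊏w₂ : u₂ ⊏ w₂
  u₂⊏w₂ = ⊏-trans u₂⊏v₂ v₂⊏w₂
  h₁⊏u₂ : h₁ ⊏ u₂
  h₁⊏u₂ = ⊑-⊏-trans h₁⊑u₁ u₁⊏u₂

  OnSpine : V → Set
  OnSpine s = x ⊑ s × s ⊑ p

  h₁-onSpine : OnSpine h₁
  h₁-onSpine = x⊑h₁ , inj₂ (⊏-⊑-trans h₁⊏u₂ (inj₂ (⊏-⊑-trans u₂⊏w₂ w₂⊑p)))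
  u₁-onSpine : OnSpine u₁
  u₁-onSpine = ⊑-trans x⊑h₁ h₁⊑u₁ , inj₂ (⊏-⊑-trans u₁⊏u₂ (inj₂ (⊏-⊑-trans u₂⊏w₂ w₂⊑p)))
  u₂-onSpine : OnSpine u₂
  u₂-onSpine = inj₂ (⊑-⊏-trans x⊑h₁ h₁⊏u₂) , inj₂ (⊏-⊑-trans u₂⊏w₂ w₂⊑p)
  v₂-onSpine : OnSpine v₂
  v₂-onSpine = inj₂ (⊏-trans (⊑-⊏-trans x⊑h₁ h₁⊏u₂) u₂⊏v₂) , inj₂ (⊏-⊑-trans v₂⊏w₂ w₂⊑p)
  w₂-onSpine : OnSpine w₂
  w₂-onSpine = inj₂ (⊏-trans (⊑-⊏-trans x⊑h₁ h₁⊏u₂) u₂⊏w₂) , w₂⊑p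

  Block₂ Block₃ OnP₂ OnP₃ : V → Set
  Block₂ z = u₂ ⊑ z × ¬ v₂ ⊑ z
  Block₃ z = v₂ ⊑ z × ¬ w₂ ⊑ z
  OnP₂ z = u₂ ⊑ z × z ⊑ v₁
  OnP₃ z = v₂ ⊑ z × z ⊑ w₁

  onSpine⇒∈U₀ : ∀ {s} → OnSpine s → s ∈ U₀
  onSpine⇒∈U₀ (x⊑s , s⊑p) = Equivalence.from (U₀-def _)
    (x⊑s , λ (y , y∈Y , y⊑s) → ⊑⇒¬⊐ (⊑-trans y⊑s s⊑p) (here (siblings y y∈Y)))

  onSpine⇒¬X : ∀ {s} → OnSpine s → col s ≢ xcol
  onSpine⇒¬X = U₀-noX _ ∘ onSpine⇒∈U₀

  onSpine⇒∈spine : ∀ {s} → OnSpine s → s ∈ˡ spine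
  onSpine⇒∈spine (x⊑s , s⊑p) = ∈-downPath spine-path x⊑s s⊑p

  private
    monochromatic : All (λ P → All (λ v → col v ≡ col (head⁺ P)) (toList P)) (P₁ ∷ P₂ ∷ P₃ ∷ P₄ ∷ C)
    monochromatic = All.++⁻ʳ Al (subst (All _) Ps≡ (proj₁ (proj₂ CI)))

    alternate : Linked (λ P Q → col (head⁺ P) ≢ col (head⁺ Q)) (P₁ ∷ P₂ ∷ P₃ ∷ P₄ ∷ C)
    alternate = Linked-++⁻ʳ Al (subst (Linked _) Ps≡ (proj₂ (proj₂ CI)))

    h₁≢u₂ : col h₁ ≢ col u₂
    h₁≢u₂ with alternate
    ... | r ∷ _ = r
    u₂≢v₂ : col u₂ ≢ col v₂
    u₂≢v₂ with alternate
    ... | _ ∷ r ∷ _ = r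
    v₂≢w₂ : col v₂ ≢ col w₂
    v₂≢w₂ with alternate
    ... | _ ∷ _ ∷ r ∷ _ = r

  c₂ c₃ : Colour
  c₂ = col u₂
  c₃ = col v₂

  c₂≢xcol : c₂ ≢ xcol
  c₂≢xcol = onSpine⇒¬X u₂-onSpine
  c₃≢xcol : c₃ ≢ xcol
  c₃≢xcol = onSpine⇒¬X v₂-onSpine
  c₂≢c₃ : c₂ ≢ c₃
  c₂≢c₃ = u₂≢v₂

  c₃≡opposite-c₂ : c₃ ≡ opposite c₂
  c₃≡opposite-c₂ = ≢⇒≡opposite c₂≢xcol c₃≢xcol c₂≢c₃
  c₂≡opposite-c₃ : c₂ ≡ opposite c₃
  c₂≡opposite-c₃ = ≢⇒≡opposite c₃≢xcol c₂≢xcol (c₂≢c₃ ∘ sym)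

  col-h₁ : col h₁ ≡ c₃
  col-h₁ = alternating (onSpine⇒¬X h₁-onSpine) c₂≢xcol c₃≢xcol h₁≢u₂ u₂≢v₂
  col-w₂ : col w₂ ≡ c₂
  col-w₂ = sym (alternating c₂≢xcol c₃≢xcol (onSpine⇒¬X w₂-onSpine) u₂≢v₂ v₂≢w₂)

  col-P₁ : ∀ {s} → h₁ ⊑ s → s ⊑ u₁ → col s ≡ c₃
  col-P₁ h₁⊑s s⊑u₁ with monochromatic
  ... | P₁-mono ∷ _ = trans (All.lookup P₁-mono (∈-downPath (proj₁ path-P₁) h₁⊑s s⊑u₁)) col-h₁
  col-P₂ : ∀ {s} → u₂ ⊑ s → s ⊑ v₁ → col s ≡ c₂
  col-P₂ u₂⊑s s⊑v₁ with monochromatic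
  ... | _ ∷ P₂-mono ∷ _ = All.lookup P₂-mono (∈-downPath (proj₁ path-P₂) u₂⊑s s⊑v₁)
  col-P₃ : ∀ {s} → v₂ ⊑ s → s ⊑ w₁ → col s ≡ c₃
  col-P₃ v₂⊑s s⊑w₁ with monochromatic
  ... | _ ∷ _ ∷ P₃-mono ∷ _ = All.lookup P₃-mono (∈-downPath (proj₁ path-P₃) v₂⊑s s⊑w₁)

  col-u₁ : col u₁ ≡ c₃
  col-u₁ = col-P₁ h₁⊑u₁ (inj₁ refl)

  Adj⇒comparable : ∀ {w y} → Adj H w y → w ≡ y ⊎ w ⊏ y ⊎ y ⊏ w
  Adj⇒comparable adj with All.lookupAny (EliminationForest.edges-comp EF) adj
  ... | comparable , w∈e , y∈e = comparable _ _ w∈e y∈e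

  Adj⇒sameColour : ∀ {w y} → Adj H w y → col w ≢ xcol → col y ≢ xcol → col w ≡ col y
  Adj⇒sameColour {w} {y} adj w≢x y≢x with All.lookupAny noRedBlue adj
  ... | noRB , w∈e , y∈e with col w in cw | col y in cy
  ... | red  | red  = refl
  ... | blue | blue = refl
  ... | red  | blue = contradiction cy (noRB w y w∈e y∈e cw)
  ... | blue | red  = contradiction cw (noRB y w y∈e w∈e cy)
  ... | xcol | _    = contradiction refl w≢x
  ... | _    | xcol = contradiction refl y≢x

  -- by induction on the number of strict descendants: reducedness joins the
  -- subtree of each child to its parent by an edge, which cannot be red–blue
  subtree-monochromatic : ∀ z → (∀ y → z ⊑ y → col y ≢ xcol) → ∀ y → z ⊑ y → col y ≡ col z
  subtree-monochromatic z = go _ z (ℕ.n<1+n _)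
    where
    below : V → Subset (n H)
    below z = subsetOf (z ⊏?_)

    fewer-below : ∀ {r z} → par r ≡ just z → ∣ below r ∣ ℕ.< ∣ below z ∣
    fewer-below {r} {z} pr = p⊂q⇒∣p∣<∣q∣
      ( (λ w∈ → Equivalence.from (below≐ z _) (⊏-trans (here pr) (Equivalence.to (below≐ r _) w∈)))
      , r , Equivalence.from (below≐ z r) (here pr)
      , λ r∈ → ⊏-irrefl (Equivalence.to (below≐ r r) r∈) refl )
      where
      below≐ : ∀ z → below z ≐ (z ⊏_)
      below≐ z = subsetOf≐ (z ⊏?_)

    go : ∀ fuel z → ∣ below z ∣ ℕ.< fuel → (∀ y → z ⊑ y → col y ≢ xcol) → ∀ y → z ⊑ y → col y ≡ col z
    go (suc fuel) z _         _   y (inj₁ refl) = refl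
    go (suc fuel) z ∣z∣<fuel noX y (inj₂ z⊏y) with ⊏⇒child z⊏y
    ... | c , pc , c⊑y with reduced z c pc
    ...   | t , c⊑t , adj = begin
      col y ≡⟨ IH y c⊑y ⟩
      col c ≡⟨ IH t c⊑t ⟨
      col t ≡⟨ Adj⇒sameColour adj (noX z (inj₁ refl)) (noX t (⊑-trans (inj₂ (here pc)) c⊑t)) ⟨
      col z ∎
      where
      open ≡-Reasoning
      IH : ∀ y → c ⊑ y → col y ≡ col c
      IH = go fuel c (ℕ.<-≤-trans (fewer-below pc) (ℕ.s≤s⁻¹ ∣z∣<fuel))
              (λ y c⊑y → noX y (⊑-trans (inj₂ (here pc)) c⊑y))

  -- F_r lies in U₀, so it avoids X; reducedness ties its colour to that of s
  offSpine-colour : ∀ {s r} → x ⊑ s → s ⊏ p → par r ≡ just s → ¬ r ⊑ p → ∀ y → r ⊑ y → col y ≡ col s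
  offSpine-colour {s} {r} x⊑s s⊏p pr r⋢p y r⊑y = trans (subtree-monochromatic r noX y r⊑y) r≡s
    where
    inU₀ : ∀ {y} → r ⊑ y → y ∈ U₀
    inU₀ {y} r⊑y = Equivalence.from (U₀-def y) (⊑-trans x⊑s (⊑-trans (inj₂ (here pr)) r⊑y) , outside-Y)
      where
      outside-Y : ¬ (∃[ y′ ] (y′ ∈ Y × y′ ⊑ y))
      outside-Y (y′ , y′∈Y , y′⊑y) with ⊑-linear r⊑y y′⊑y
      ... | inj₁ (inj₁ refl) = ⊏-irrefl s⊏p (just-injective (trans (sym pr) (siblings y′ y′∈Y)))
      ... | inj₁ (inj₂ r⊏y′) = r⋢p (⊏-parent (siblings y′ y′∈Y) r⊏y′)
      ... | inj₂ y′⊏r = ⊑⇒¬⊐ (⊑-trans (⊏-parent pr y′⊏r) (inj₂ s⊏p)) (here (siblings y′ y′∈Y))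
    noX : ∀ y → r ⊑ y → col y ≢ xcol
    noX y r⊑y = U₀-noX y (inU₀ r⊑y)
    r≡s : col r ≡ col s
    r≡s with reduced s r pr
    ... | t , r⊑t , adj = trans (sym (subtree-monochromatic r noX t r⊑t))
                                (sym (Adj⇒sameColour adj (onSpine⇒¬X (x⊑s , inj₂ s⊏p)) (noX t r⊑t)))

  offSpine-branch : ∀ {t z} → t ⊑ p → t ⊏ z → ¬ z ⊑ p →
                    ∃[ s ] ∃[ r ] (par r ≡ just s × t ⊑ s × s ⊑ p × ¬ r ⊑ p × r ⊑ z)
  offSpine-branch t⊑p (here e) z⋢p = _ , _ , e , inj₁ refl , t⊑p , z⋢p , inj₁ refl
  offSpine-branch {z = z} t⊑p (there {b = b} e t⊏b) z⋢p with b ⊑? p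
  ... | yes b⊑p = b , z , e , inj₂ t⊏b , b⊑p , z⋢p , inj₁ refl
  ... | no  b⋢p with offSpine-branch t⊑p t⊏b b⋢p
  ...   | s , r , pr , t⊑s , s⊑p , r⋢p , r⊑b = s , r , pr , t⊑s , s⊑p , r⋢p , ⊑-trans r⊑b (inj₂ (here e))

  Bag XBall FBall Core : V → V → Set
  Bag   = InBag H par
  XBall = InXBall H col par
  FBall = InFBall H col par
  Core u w = Bag u w × (col w ≢ opposite (col u) ⊎ XBall u w)

  XBall-transfer : ∀ {s t} → OnSpine s → OnSpine t → ∀ {w} → XBall s w → XBall t w
  XBall-transfer s-on t-on {w} =
    Equivalence.to (All.lookup (All.lookup XH (onSpine⇒∈spine s-on)) (onSpine⇒∈spine t-on) w)

  Bag? : ∀ u w → Dec (Bag u w)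
  Bag? u w = (w ≟ u) Dec.⊎-dec ((w ⊏? u) ×-dec Fin.any? (λ z → (u ⊑? z) ×-dec Adj? w z))

  XBall? : ∀ u w → Dec (XBall u w)
  XBall? u w = Fin.any? λ z → (col z ≟ᶜ xcol) ×-dec Conn? (Bag? u) z w

  XBall⇒Bag : ∀ {u w} → XBall u w → Bag u w
  XBall⇒Bag (_ , _ , c) = Conn-target c

  X⇒XBall : ∀ {u w} → Bag u w → col w ≡ xcol → XBall u w
  X⇒XBall b w≡x = _ , w≡x , start b

  XBall-extend : ∀ {u w w′} → XBall u w → Adj H w w′ → Bag u w′ → XBall u w′
  XBall-extend (z , z≡x , c) adj b = z , z≡x , step c adj b

  NoX : V → V → Set
  NoX u w = ∀ t → Conn H (Bag u) w t → col t ≢ xcol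

  NoX⇔¬XBall : ∀ {u w} → NoX u w ⇔ (¬ XBall u w)
  NoX⇔¬XBall = mk⇔ (λ noX (z , z≡x , c) → noX z (Conn-sym c) z≡x)
                   (λ ¬xball t c t≡x → ¬xball (t , t≡x , Conn-sym c))

  FBall⇒col : ∀ {u w} → FBall u w → col w ≡ opposite (col u)
  FBall⇒col (_ , _ , other) = proj₂ (Equivalence.to OtherColour⇔ other)

  FBall? : ∀ u w → Dec (FBall u w)
  FBall? u w = Bag? u w ×-dec (Dec.map (⇔-sym NoX⇔¬XBall) (¬? (XBall? u w)) ×-dec OtherColour? (col u) (col w))

  Core? : ∀ u w → Dec (Core u w)
  Core? u w = Bag? u w ×-dec (¬? (col w ≟ᶜ opposite (col u)) Dec.⊎-dec XBall? u w)

  Bag⇔Core⊎FBall : ∀ {u} → col u ≢ xcol → ∀ w → Bag u w ⇔ (Core u w ⊎ FBall u w)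
  Bag⇔Core⊎FBall {u} u≢x w = mk⇔ split λ { (inj₁ core) → proj₁ core ; (inj₂ fball) → proj₁ fball }
    where
    split : Bag u w → Core u w ⊎ FBall u w
    split b with XBall? u w
    ... | yes xball = inj₁ (b , inj₂ xball)
    ... | no ¬xball with col w ≟ᶜ opposite (col u)
    ...   | yes w≡ = inj₂ (b , Equivalence.from NoX⇔¬XBall ¬xball , Equivalence.from OtherColour⇔ (u≢x , w≡))
    ...   | no w≢ = inj₁ (b , inj₁ w≢)

  module _ {z z′ : V} (z≢x : col z ≢ xcol) (z≡z′ : col z ≡ col z′)
           (xball⊆ : ∀ {w} → XBall z w → XBall z′ w) where

    Core-FBall-disjoint : ∀ {w} → Core z w → FBall z′ w → ⊥
    Core-FBall-disjoint (_ , inj₁ w≢) fball = w≢ (trans (FBall⇒col fball) (cong opposite (sym z≡z′)))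
    Core-FBall-disjoint (_ , inj₂ xball) (_ , noX , _) = Equivalence.to NoX⇔¬XBall noX (xball⊆ xball)

    -- an edge leaving a foreign ball ends in X (impossible) or in the foreign colour
    Core-FBall-nonadjacent : ∀ {w y} → Adj H w y → Core z w → FBall z′ y → ⊥
    Core-FBall-nonadjacent {w} {y} adj (b , core) fball@(b′ , noX , _) with col w ≟ᶜ xcol
    ... | yes w≡x = Equivalence.to NoX⇔¬XBall noX (XBall-extend (xball⊆ (X⇒XBall b w≡x)) adj b′)
    ... | no  w≢x with core
    ...   | inj₂ xball = Equivalence.to NoX⇔¬XBall noX (XBall-extend (xball⊆ xball) adj b′)
    ...   | inj₁ w≢opp = w≢opp (trans (Adj⇒sameColour adj w≢x y≢x) y≡opp)
      where
      y≡opp : col y ≡ opposite (col z)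
      y≡opp = trans (FBall⇒col fball) (cong opposite (sym z≡z′))
      y≢x : col y ≢ xcol
      y≢x y≡x = opposite-≢xcol z≢x (trans (sym y≡opp) y≡x)

  -- t and b are the first and last vertex of a colour interval of colour c, and b′
  -- follows b on the spine
  module ColourInterval {t b b′ : V} {c : Colour} (t-on : OnSpine t) (pb : par b′ ≡ just b) (b′⊑p : b′ ⊑ p)
                        (interval : ∀ {s} → t ⊑ s → s ⊑ b → col s ≡ c) where

    -- the vertices of F_t outside F_b′ hang off the interval
    block-colour : ∀ {z} → t ⊑ z → ¬ b′ ⊑ z → col z ≡ c
    block-colour {z} t⊑z b′⋢z with z ⊑? p
    ... | yes z⊑p with ⊑-linear z⊑p b′⊑p
    ...   | inj₂ b′⊏z        = contradiction (inj₂ b′⊏z) b′⋢z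
    ...   | inj₁ (inj₁ refl) = contradiction (inj₁ refl) b′⋢z
    ...   | inj₁ (inj₂ z⊏b′) = interval t⊑z (⊏-parent pb z⊏b′)
    block-colour (inj₁ refl) b′⋢z | no z⋢p = contradiction (proj₂ t-on) z⋢p
    block-colour (inj₂ t⊏z)  b′⋢z | no z⋢p with offSpine-branch (proj₂ t-on) t⊏z z⋢p
    ... | s , r , pr , t⊑s , s⊑p , r⋢p , r⊑z with ⊑-linear s⊑p b′⊑p
    ...   | inj₂ b′⊏s        = contradiction (inj₂ (⊏-⊑-trans (⊏-trans b′⊏s (here pr)) r⊑z)) b′⋢z
    ...   | inj₁ (inj₁ refl) = contradiction (inj₂ (⊏-⊑-trans (here pr) r⊑z)) b′⋢z
    ...   | inj₁ (inj₂ s⊏b′) =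
      trans (offSpine-colour (⊑-trans (proj₁ t-on) t⊑s) (⊏-⊑-trans s⊏b′ b′⊑p) pr r⋢p _ r⊑z)
            (interval t⊑s (⊏-parent pb s⊏b′))

    -- X-balls agree by homogeneity; a vertex of the opposite colour adjacent to F_s
    -- lies above t and is adjacent to F_t, and conversely
    module _ {s : V} (t⊑s : t ⊑ s) (s⊑b : s ⊑ b) where

      private
        b′⋢s : ¬ b′ ⊑ s
        b′⋢s b′⊑s = ⊑⇒¬⊐ (⊑-trans b′⊑s s⊑b) (here pb)
        s-on : OnSpine s
        s-on = ⊑-trans (proj₁ t-on) t⊑s , ⊑-trans s⊑b (⊑-trans (inj₂ (here pb)) b′⊑p)
        col-s : col s ≡ c
        col-s = interval t⊑s s⊑b
        col-t : col t ≡ c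
        col-t = interval (inj₁ refl) (⊑-trans t⊑s s⊑b)
        c≢xcol : c ≢ xcol
        c≢xcol c≡x = onSpine⇒¬X t-on (trans col-t c≡x)
        opposite⇒≢c : ∀ {y} → col y ≡ opposite c → col y ≢ c
        opposite⇒≢c y≡opp y≡c = opposite-≢ c≢xcol (trans (sym y≡opp) y≡c)

      Bag-s⇒Bag-t : ∀ {w} → col w ≡ opposite c → Bag s w → Bag t w
      Bag-s⇒Bag-t w≡opp (inj₁ refl) = contradiction col-s (opposite⇒≢c w≡opp)
      Bag-s⇒Bag-t {w} w≡opp (inj₂ (w⊏s , y , s⊑y , adj)) = inj₂ (w⊏t , y , ⊑-trans t⊑s s⊑y , adj)
        where
        w⊏t : w ⊏ t
        w⊏t with t ⊑? w
        ... | yes t⊑w =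
          contradiction (block-colour t⊑w λ b′⊑w → b′⋢s (⊑-trans b′⊑w (inj₂ w⊏s))) (opposite⇒≢c w≡opp)
        ... | no  t⋢w with ⊑-linear (inj₂ w⊏s) t⊑s
        ...   | inj₂ t⊏w        = contradiction (inj₂ t⊏w) t⋢w
        ...   | inj₁ (inj₁ refl) = contradiction (inj₁ refl) t⋢w
        ...   | inj₁ (inj₂ w⊏t) = w⊏t

      Bag-t⇒Bag-s : ∀ {w} → col w ≡ opposite c → Bag t w → Bag s w
      Bag-t⇒Bag-s w≡opp (inj₁ refl) = contradiction col-t (opposite⇒≢c w≡opp)
      Bag-t⇒Bag-s {w} w≡opp (inj₂ (w⊏t , y , t⊑y , adj)) = inj₂ (⊏-⊑-trans w⊏t t⊑s , y , s⊑y , adj)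
        where
        s⊑y : s ⊑ y
        s⊑y with b′ ⊑? y
        ... | yes b′⊑y = ⊑-trans s⊑b (⊑-trans (inj₂ (here pb)) b′⊑y)
        ... | no  b′⋢y = contradiction (Adj⇒sameColour adj w≢x y≢x) λ w≡y →
                           opposite⇒≢c w≡opp (trans w≡y (block-colour t⊑y b′⋢y))
          where
          w≢x : col w ≢ xcol
          w≢x w≡x = opposite-≢xcol c≢xcol (trans (sym w≡opp) w≡x)
          y≢x : col y ≢ xcol
          y≢x y≡x = c≢xcol (trans (sym (block-colour t⊑y b′⋢y)) y≡x)

      FBall-constant : ∀ w → FBall s w ⇔ FBall t w
      FBall-constant w = mk⇔ to from
        where
        otherColour : ∀ {u} → col u ≡ c → col w ≡ opposite c → OtherColour (col u) (col w)
        otherColour u≡c w≡opp =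
          Equivalence.from OtherColour⇔
            ((λ u≡x → c≢xcol (trans (sym u≡c) u≡x)) , trans w≡opp (cong opposite (sym u≡c)))
        w≡opposite-c : ∀ {u} → col u ≡ c → OtherColour (col u) (col w) → col w ≡ opposite c
        w≡opposite-c u≡c other = trans (proj₂ (Equivalence.to OtherColour⇔ other)) (cong opposite u≡c)
        to : FBall s w → FBall t w
        to (b , noX , other) =
          Bag-s⇒Bag-t (w≡opposite-c col-s other) b ,
          Equivalence.from NoX⇔¬XBall (Equivalence.to NoX⇔¬XBall noX ∘ XBall-transfer t-on s-on) ,
          otherColour col-t (w≡opposite-c col-s other)
        from : FBall t w → FBall s w
        from (b , noX , other) =
          Bag-t⇒Bag-s (w≡opposite-c col-t other) b ,
          Equivalence.from NoX⇔¬XBall (Equivalence.to NoX⇔¬XBall noX ∘ XBall-transfer s-on t-on) ,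
          otherColour col-s (w≡opposite-c col-t other)

  module Interval₁ = ColourInterval h₁-onSpine par-u₂ (proj₂ u₂-onSpine) col-P₁
  module Interval₂ = ColourInterval u₂-onSpine par-v₂ (proj₂ v₂-onSpine) col-P₂
  module Interval₃ = ColourInterval v₂-onSpine par-w₂ w₂⊑p col-P₃

  col-block₁ : ∀ {z} → h₁ ⊑ z → ¬ u₂ ⊑ z → col z ≡ c₃
  col-block₁ = Interval₁.block-colour
  col-block₂ : ∀ {z} → u₂ ⊑ z → ¬ v₂ ⊑ z → col z ≡ c₂
  col-block₂ = Interval₂.block-colour
  col-block₃ : ∀ {z} → v₂ ⊑ z → ¬ w₂ ⊑ z → col z ≡ c₃
  col-block₃ = Interval₃.block-colour

  FBall-P₁ : ∀ w → FBall u₁ w ⇔ FBall h₁ w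
  FBall-P₁ = Interval₁.FBall-constant h₁⊑u₁ (inj₁ refl)
  FBall-P₂ : ∀ {z} → OnP₂ z → ∀ w → FBall z w ⇔ FBall u₂ w
  FBall-P₂ (u₂⊑z , z⊑v₁) = Interval₂.FBall-constant u₂⊑z z⊑v₁
  FBall-P₃ : ∀ {z} → OnP₃ z → ∀ w → FBall z w ⇔ FBall v₂ w
  FBall-P₃ (v₂⊑z , z⊑w₁) = Interval₃.FBall-constant v₂⊑z z⊑w₁

  ≡c₂⇒≢xcol : ∀ {w} → col w ≡ c₂ → col w ≢ xcol
  ≡c₂⇒≢xcol w≡c₂ w≡x = c₂≢xcol (trans (sym w≡c₂) w≡x)
  ≡c₃⇒≢xcol : ∀ {w} → col w ≡ c₃ → col w ≢ xcol
  ≡c₃⇒≢xcol w≡c₃ w≡x = c₃≢xcol (trans (sym w≡c₃) w≡x)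

  c₂-c₃-¬Adj : ∀ {w y} → col w ≡ c₂ → col y ≡ c₃ → ¬ Adj H w y
  c₂-c₃-¬Adj {w} {y} w≡c₂ y≡c₃ adj = c₂≢c₃ (begin
    c₂    ≡⟨ w≡c₂ ⟨
    col w ≡⟨ Adj⇒sameColour adj (≡c₂⇒≢xcol w≡c₂) (≡c₃⇒≢xcol y≡c₃) ⟩
    col y ≡⟨ y≡c₃ ⟩
    c₃    ∎)
    where open ≡-Reasoning

  c₃-c₂-¬Adj : ∀ {w y} → col w ≡ c₃ → col y ≡ c₂ → ¬ Adj H w y
  c₃-c₂-¬Adj w≡c₃ y≡c₂ = c₂-c₃-¬Adj y≡c₂ w≡c₃ ∘ Adj-sym

  OtherColour-c₃-c₂ : ∀ {u w} → col u ≡ c₃ → col w ≡ c₂ → OtherColour (col u) (col w)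
  OtherColour-c₃-c₂ u≡c₃ w≡c₂ = Equivalence.from OtherColour⇔
    (≡c₃⇒≢xcol u≡c₃ , trans w≡c₂ (trans c₂≡opposite-c₃ (cong opposite (sym u≡c₃))))

  OtherColour-c₂-c₃ : ∀ {u w} → col u ≡ c₂ → col w ≡ c₃ → OtherColour (col u) (col w)
  OtherColour-c₂-c₃ u≡c₂ w≡c₃ = Equivalence.from OtherColour⇔
    (≡c₂⇒≢xcol u≡c₂ , trans w≡c₃ (trans c₃≡opposite-c₂ (cong opposite (sym u≡c₂))))

  par′ : Parent (n H)
  par′ = swapParent par P₁ P₂ P₃ P₄

  open Ancestry par′ using ()
    renaming ( _⊏_ to infix 4 _⊏′_; _⊑_ to infix 4 _⊑′_
             ; ⊏-trans to ⊏′-trans; ⊑-⊏-trans to ⊑′-⊏′-trans; ⊏-⊑-trans to ⊏′-⊑′-trans)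

  par′-v₂ : par′ v₂ ≡ just u₁
  par′-v₂ with v₂ ≟ v₂
  ... | yes _   = refl
  ... | no v₂≢v₂ = contradiction refl v₂≢v₂

  par′-u₂ : par′ u₂ ≡ just w₁
  par′-u₂ with u₂ ≟ v₂
  ... | yes u₂≡v₂ = contradiction u₂≡v₂ (⊏-irrefl u₂⊏v₂)
  ... | no _ with u₂ ≟ u₂
  ...   | yes _    = refl
  ...   | no u₂≢u₂ = contradiction refl u₂≢u₂

  par′-w₂ : par′ w₂ ≡ just v₁
  par′-w₂ with w₂ ≟ v₂
  ... | yes w₂≡v₂ = contradiction (sym w₂≡v₂) (⊏-irrefl v₂⊏w₂)
  ... | no _ with w₂ ≟ u₂
  ...   | yes w₂≡u₂ = contradiction (sym w₂≡u₂) (⊏-irrefl u₂⊏w₂)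
  ...   | no _ with w₂ ≟ w₂
  ...     | yes _    = refl
  ...     | no w₂≢w₂ = contradiction refl w₂≢w₂

  Unmoved : V → Set
  Unmoved v = v ≢ v₂ × v ≢ u₂ × v ≢ w₂

  par′-unmoved : ∀ {v} → Unmoved v → par′ v ≡ par v
  par′-unmoved {v} (v≢v₂ , v≢u₂ , v≢w₂) with v ≟ v₂
  ... | yes v≡v₂ = contradiction v≡v₂ v≢v₂
  ... | no _ with v ≟ u₂
  ...   | yes v≡u₂ = contradiction v≡u₂ v≢u₂
  ...   | no _ with v ≟ w₂
  ...     | yes v≡w₂ = contradiction v≡w₂ v≢w₂
  ...     | no _     = refl

  data SwapView (z : V) : Set where
    at-v₂   : z ≡ v₂ → SwapView z
    at-u₂   : z ≡ u₂ → SwapView z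
    at-w₂   : z ≡ w₂ → SwapView z
    unmoved : Unmoved z → SwapView z

  swapView : ∀ z → SwapView z
  swapView z with z ≟ v₂ | z ≟ u₂ | z ≟ w₂
  ... | yes e    | _        | _        = at-v₂ e
  ... | no _     | yes e    | _        = at-u₂ e
  ... | no _     | no _     | yes e    = at-w₂ e
  ... | no z≢v₂  | no z≢u₂  | no z≢w₂  = unmoved (z≢v₂ , z≢u₂ , z≢w₂)

  col-Block₂ : ∀ {z} → Block₂ z → col z ≡ c₂
  col-Block₂ (u₂⊑z , v₂⋢z) = col-block₂ u₂⊑z v₂⋢z
  col-Block₃ : ∀ {z} → Block₃ z → col z ≡ c₃
  col-Block₃ (v₂⊑z , w₂⋢z) = col-block₃ v₂⊑z w₂⋢z

  -- The swap hangs the block F_u₂ ∖ F_v₂ below P₃: it stops being above the block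
  -- F_v₂ ∖ F_w₂ and gains the vertices of P₃ as ancestors; nothing else changes.
  SwapAnc : V → V → Set
  SwapAnc a z = (a ⊏ z × ¬ (Block₂ a × Block₃ z)) ⊎ (Block₂ z × OnP₃ a)

  Block₂-u₂ : Block₂ u₂
  Block₂-u₂ = inj₁ refl , λ v₂⊑u₂ → ⊑⇒¬⊐ v₂⊑u₂ u₂⊏v₂
  Block₂-v₁ : Block₂ v₁
  Block₂-v₁ = u₂⊑v₁ , λ v₂⊑v₁ → ⊑⇒¬⊐ v₂⊑v₁ v₁⊏v₂
  Block₃-w₁ : Block₃ w₁
  Block₃-w₁ = v₂⊑w₁ , λ w₂⊑w₁ → ⊑⇒¬⊐ w₂⊑w₁ w₁⊏w₂
  OnP₃-v₂ : OnP₃ v₂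
  OnP₃-v₂ = inj₁ refl , v₂⊑w₁
  OnP₃-w₁ : OnP₃ w₁
  OnP₃-w₁ = v₂⊑w₁ , inj₁ refl

  ¬Block₃-w₂ : ¬ Block₃ w₂
  ¬Block₃-w₂ (_ , w₂⋢w₂) = w₂⋢w₂ (inj₁ refl)

  SwapAnc-parent′ : ∀ {z b} → par′ z ≡ just b → SwapAnc b z
  SwapAnc-parent′ {z} {b} pz′ with swapView z
  ... | unmoved um = inj₁ (here pz , λ ((_ , v₂⋢b) , v₂⊑z , _) → v₂⋢b (⊑-parent pz v₂⊑z (proj₁ um)))
    where
    pz : par z ≡ just b
    pz = trans (sym (par′-unmoved um)) pz′
  ... | at-v₂ refl with just-injective (trans (sym par′-v₂) pz′)
  ...   | refl = inj₁ (⊏-trans u₁⊏u₂ u₂⊏v₂ , λ ((u₂⊑u₁ , _) , _) → ⊑⇒¬⊐ u₂⊑u₁ u₁⊏u₂)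
  SwapAnc-parent′ pz′ | at-u₂ refl with just-injective (trans (sym par′-u₂) pz′)
  ...   | refl = inj₂ (Block₂-u₂ , OnP₃-w₁)
  SwapAnc-parent′ pz′ | at-w₂ refl with just-injective (trans (sym par′-w₂) pz′)
  ...   | refl = inj₁ (⊏-trans v₁⊏v₂ v₂⊏w₂ , ¬Block₃-w₂ ∘ proj₂)

  SwapAnc-extend-unmoved : ∀ {a z b} → Unmoved z → par z ≡ just b → SwapAnc a b → SwapAnc a z
  SwapAnc-extend-unmoved um pz (inj₁ (a⊏b , ¬both)) = inj₁ (there pz a⊏b , λ (block₂-a , v₂⊑z , w₂⋢z) →
    ¬both (block₂-a , ⊑-parent pz v₂⊑z (proj₁ um) , λ w₂⊑b → w₂⋢z (⊑-trans w₂⊑b (inj₂ (here pz)))))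
  SwapAnc-extend-unmoved um pz (inj₂ ((u₂⊑b , v₂⋢b) , onP₃-a)) =
    inj₂ ((⊑-trans u₂⊑b (inj₂ (here pz)) , λ v₂⊑z → v₂⋢b (⊑-parent pz v₂⊑z (proj₁ um))) , onP₃-a)

  SwapAnc-extend-v₂ : ∀ {a} → SwapAnc a u₁ → SwapAnc a v₂
  SwapAnc-extend-v₂ (inj₁ (a⊏u₁ , _)) =
    inj₁ (⊏-trans a⊏u₁ (⊏-trans u₁⊏u₂ u₂⊏v₂) , λ ((u₂⊑a , _) , _) → ⊑⇒¬⊐ u₂⊑a (⊏-trans a⊏u₁ u₁⊏u₂))
  SwapAnc-extend-v₂ (inj₂ ((u₂⊑u₁ , _) , _)) = contradiction u₁⊏u₂ (⊑⇒¬⊐ u₂⊑u₁)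

  SwapAnc-extend-u₂ : ∀ {a} → SwapAnc a w₁ → SwapAnc a u₂
  SwapAnc-extend-u₂ (inj₂ ((_ , v₂⋢w₁) , _)) = contradiction v₂⊑w₁ v₂⋢w₁
  SwapAnc-extend-u₂ {a} (inj₁ (a⊏w₁ , ¬both)) with ⊑-linear (inj₂ a⊏w₁) v₂⊑w₁
  ... | inj₂ v₂⊏a        = inj₂ (Block₂-u₂ , inj₂ v₂⊏a , inj₂ a⊏w₁)
  ... | inj₁ (inj₁ refl) = inj₂ (Block₂-u₂ , OnP₃-v₂)
  ... | inj₁ (inj₂ a⊏v₂) with u₂ ⊑? a
  ...   | yes u₂⊑a = contradiction ((u₂⊑a , λ v₂⊑a → ⊑⇒¬⊐ v₂⊑a a⊏v₂) , Block₃-w₁) ¬both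
  ...   | no  u₂⋢a with ⊑-linear (⊏-parent par-v₂ a⊏v₂) u₂⊑v₁
  ...     | inj₂ u₂⊏a        = contradiction (inj₂ u₂⊏a) u₂⋢a
  ...     | inj₁ (inj₁ refl) = contradiction (inj₁ refl) u₂⋢a
  ...     | inj₁ (inj₂ a⊏u₂) = inj₁ (a⊏u₂ , λ (_ , v₂⊑u₂ , _) → ⊑⇒¬⊐ v₂⊑u₂ u₂⊏v₂)

  SwapAnc-extend-w₂ : ∀ {a} → SwapAnc a v₁ → SwapAnc a w₂
  SwapAnc-extend-w₂ (inj₁ (a⊏v₁ , _))     = inj₁ (⊏-trans a⊏v₁ (⊏-trans v₁⊏v₂ v₂⊏w₂) , ¬Block₃-w₂ ∘ proj₂)
  SwapAnc-extend-w₂ (inj₂ (_ , _ , a⊑w₁)) = inj₁ (⊑-⊏-trans a⊑w₁ w₁⊏w₂ , ¬Block₃-w₂ ∘ proj₂)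

  SwapAnc-extend′ : ∀ {a z b} → par′ z ≡ just b → SwapAnc a b → SwapAnc a z
  SwapAnc-extend′ {z = z} pz′ anc with swapView z
  ... | unmoved um = SwapAnc-extend-unmoved um (trans (sym (par′-unmoved um)) pz′) anc
  ... | at-v₂ refl with just-injective (trans (sym par′-v₂) pz′)
  ...   | refl = SwapAnc-extend-v₂ anc
  SwapAnc-extend′ pz′ anc | at-u₂ refl with just-injective (trans (sym par′-u₂) pz′)
  ...   | refl = SwapAnc-extend-u₂ anc
  SwapAnc-extend′ pz′ anc | at-w₂ refl with just-injective (trans (sym par′-w₂) pz′)
  ...   | refl = SwapAnc-extend-w₂ anc

  ⊏′⇒SwapAnc : ∀ {a z} → a ⊏′ z → SwapAnc a z
  ⊏′⇒SwapAnc (here e)       = SwapAnc-parent′ e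
  ⊏′⇒SwapAnc (there e a⊏′b) = SwapAnc-extend′ e (⊏′⇒SwapAnc a⊏′b)

  ⊏⇒⊏′-unmoved : ∀ {a z} → a ⊏ z → (∀ {s} → s ⊑ z → a ⊏ s → Unmoved s) → a ⊏′ z
  ⊏⇒⊏′-unmoved (here pz) untouched = here (trans (par′-unmoved (untouched (inj₁ refl) (here pz))) pz)
  ⊏⇒⊏′-unmoved (there pz a⊏b) untouched =
    there (trans (par′-unmoved (untouched (inj₁ refl) (there pz a⊏b))) pz)
          (⊏⇒⊏′-unmoved a⊏b λ s⊑b a⊏s → untouched (⊑-trans s⊑b (inj₂ (here pz))) a⊏s)

  ⊏⇒⊏′-outside-u₂ : ∀ {a z} → ¬ u₂ ⊑ z → a ⊏ z → a ⊏′ z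
  ⊏⇒⊏′-outside-u₂ u₂⋢z a⊏z = ⊏⇒⊏′-unmoved a⊏z λ s⊑z _ →
      (λ { refl → u₂⋢z (⊑-trans (inj₂ u₂⊏v₂) s⊑z) })
    , (λ { refl → u₂⋢z s⊑z })
    , (λ { refl → u₂⋢z (⊑-trans (inj₂ u₂⊏w₂) s⊑z) })

  ⊏⇒⊏′-within-u₂ : ∀ {a z} → Block₂ z → u₂ ⊑ a → a ⊏ z → a ⊏′ z
  ⊏⇒⊏′-within-u₂ (_ , v₂⋢z) u₂⊑a a⊏z = ⊏⇒⊏′-unmoved a⊏z λ s⊑z a⊏s →
      (λ { refl → v₂⋢z s⊑z })
    , (λ { refl → ⊑⇒¬⊐ u₂⊑a a⊏s })
    , (λ { refl → v₂⋢z (⊑-trans (inj₂ v₂⊏w₂) s⊑z) })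

  ⊏⇒⊏′-within-v₂ : ∀ {a z} → Block₃ z → v₂ ⊑ a → a ⊏ z → a ⊏′ z
  ⊏⇒⊏′-within-v₂ (_ , w₂⋢z) v₂⊑a a⊏z = ⊏⇒⊏′-unmoved a⊏z λ s⊑z a⊏s →
      (λ { refl → ⊑⇒¬⊐ v₂⊑a a⊏s })
    , (λ { refl → ⊑⇒¬⊐ (inj₂ u₂⊏v₂) (⊑-⊏-trans v₂⊑a a⊏s) })
    , (λ { refl → w₂⋢z s⊑z })

  ⊏⇒⊏′-within-w₂ : ∀ {a z} → w₂ ⊑ a → a ⊏ z → a ⊏′ z
  ⊏⇒⊏′-within-w₂ w₂⊑a a⊏z = ⊏⇒⊏′-unmoved a⊏z λ _ a⊏s →
      (λ { refl → ⊑⇒¬⊐ (inj₂ v₂⊏w₂) (⊑-⊏-trans w₂⊑a a⊏s) })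
    , (λ { refl → ⊑⇒¬⊐ (inj₂ u₂⊏w₂) (⊑-⊏-trans w₂⊑a a⊏s) })
    , (λ { refl → ⊑⇒¬⊐ w₂⊑a a⊏s })

  Block₂⇒u₂⊑′ : ∀ {z} → Block₂ z → u₂ ⊑′ z
  Block₂⇒u₂⊑′ (inj₁ refl , _)          = inj₁ refl
  Block₂⇒u₂⊑′ block₂@(inj₂ u₂⊏z , _)   = inj₂ (⊏⇒⊏′-within-u₂ block₂ (inj₁ refl) u₂⊏z)

  Block₃⇒v₂⊑′ : ∀ {z} → Block₃ z → v₂ ⊑′ z
  Block₃⇒v₂⊑′ (inj₁ refl , _)          = inj₁ refl
  Block₃⇒v₂⊑′ block₃@(inj₂ v₂⊏z , _)   = inj₂ (⊏⇒⊏′-within-v₂ block₃ (inj₁ refl) v₂⊏z)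

  w₂⊑⇒w₂⊑′ : ∀ {z} → w₂ ⊑ z → w₂ ⊑′ z
  w₂⊑⇒w₂⊑′ (inj₁ refl) = inj₁ refl
  w₂⊑⇒w₂⊑′ (inj₂ w₂⊏z) = inj₂ (⊏⇒⊏′-within-w₂ (inj₁ refl) w₂⊏z)

  ⊑u₁⇒⊑′u₁ : ∀ {a} → a ⊑ u₁ → a ⊑′ u₁
  ⊑u₁⇒⊑′u₁ (inj₁ refl) = inj₁ refl
  ⊑u₁⇒⊑′u₁ (inj₂ a⊏u₁) = inj₂ (⊏⇒⊏′-outside-u₂ (λ u₂⊑u₁ → ⊑⇒¬⊐ u₂⊑u₁ u₁⊏u₂) a⊏u₁)

  OnP₃⇒⊑′w₁ : ∀ {a} → OnP₃ a → a ⊑′ w₁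
  OnP₃⇒⊑′w₁ (_ , inj₁ refl)     = inj₁ refl
  OnP₃⇒⊑′w₁ (v₂⊑a , inj₂ a⊏w₁) = inj₂ (⊏⇒⊏′-within-v₂ Block₃-w₁ v₂⊑a a⊏w₁)

  ⊏⇒⊏′-v₂ : ∀ {a} → ¬ u₂ ⊑ a → a ⊏ v₂ → a ⊏′ v₂
  ⊏⇒⊏′-v₂ u₂⋢a a⊏v₂ with ⊑-linear (inj₂ a⊏v₂) (inj₂ u₂⊏v₂)
  ... | inj₂ u₂⊏a        = contradiction (inj₂ u₂⊏a) u₂⋢a
  ... | inj₁ (inj₁ refl) = contradiction (inj₁ refl) u₂⋢a
  ... | inj₁ (inj₂ a⊏u₂) = ⊑′-⊏′-trans (⊑u₁⇒⊑′u₁ (⊏-parent par-u₂ a⊏u₂)) (here par′-v₂)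

  SwapAnc⇒⊏′-block₃ : ∀ {a z} → Block₃ z → SwapAnc a z → a ⊏′ z
  SwapAnc⇒⊏′-block₃ block₃ (inj₂ ((_ , v₂⋢z) , _)) = contradiction (proj₁ block₃) v₂⋢z
  SwapAnc⇒⊏′-block₃ {a} block₃ (inj₁ (a⊏z , ¬both)) with v₂ ⊑? a
  ... | yes v₂⊑a = ⊏⇒⊏′-within-v₂ block₃ v₂⊑a a⊏z
  ... | no  v₂⋢a with u₂ ⊑? a
  ...   | yes u₂⊑a = contradiction ((u₂⊑a , v₂⋢a) , block₃) ¬both
  ...   | no  u₂⋢a with ⊑-linear (inj₂ a⊏z) (proj₁ block₃)
  ...     | inj₂ v₂⊏a        = contradiction (inj₂ (⊏-trans u₂⊏v₂ v₂⊏a)) u₂⋢a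
  ...     | inj₁ (inj₁ refl) = contradiction (inj₂ u₂⊏v₂) u₂⋢a
  ...     | inj₁ (inj₂ a⊏v₂) = ⊏′-⊑′-trans (⊏⇒⊏′-v₂ u₂⋢a a⊏v₂) (Block₃⇒v₂⊑′ block₃)

  SwapAnc⇒⊏′-block₂ : ∀ {a z} → Block₂ z → SwapAnc a z → a ⊏′ z
  SwapAnc⇒⊏′-block₂ block₂ (inj₂ (_ , onP₃-a)) =
    ⊏′-⊑′-trans (⊑′-⊏′-trans (OnP₃⇒⊑′w₁ onP₃-a) (here par′-u₂)) (Block₂⇒u₂⊑′ block₂)
  SwapAnc⇒⊏′-block₂ {a} block₂ (inj₁ (a⊏z , ¬both)) with u₂ ⊑? a
  ... | yes u₂⊑a = ⊏⇒⊏′-within-u₂ block₂ u₂⊑a a⊏z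
  ... | no  u₂⋢a with ⊑-linear (inj₂ a⊏z) (proj₁ block₂)
  ...   | inj₂ u₂⊏a        = contradiction (inj₂ u₂⊏a) u₂⋢a
  ...   | inj₁ (inj₁ refl) = contradiction (inj₁ refl) u₂⋢a
  ...   | inj₁ (inj₂ a⊏u₂) = ⊏′-⊑′-trans (⊏′-trans a⊏′w₁ (here par′-u₂)) (Block₂⇒u₂⊑′ block₂)
    where
    a⊏w₁ : a ⊏ w₁
    a⊏w₁ = ⊏-trans a⊏u₂ (⊑-⊏-trans u₂⊑v₁ (⊏-⊑-trans v₁⊏v₂ v₂⊑w₁))
    a⊏′w₁ : a ⊏′ w₁
    a⊏′w₁ = SwapAnc⇒⊏′-block₃ Block₃-w₁ (inj₁ (a⊏w₁ , λ ((u₂⊑a , _) , _) → u₂⋢a u₂⊑a))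

  ⊑w₁⇒⊑′v₁ : ∀ {a} → a ⊑ w₁ → a ⊑′ v₁
  ⊑w₁⇒⊑′v₁ a⊑w₁ with ⊑-linear a⊑w₁ v₂⊑w₁
  ... | inj₂ v₂⊏a        = inj₂ (SwapAnc⇒⊏′-block₂ Block₂-v₁ (inj₂ (Block₂-v₁ , inj₂ v₂⊏a , a⊑w₁)))
  ... | inj₁ (inj₁ refl) = inj₂ (SwapAnc⇒⊏′-block₂ Block₂-v₁ (inj₂ (Block₂-v₁ , OnP₃-v₂)))
  ... | inj₁ (inj₂ a⊏v₂) with ⊏-parent par-v₂ a⊏v₂
  ...   | inj₁ refl  = inj₁ refl
  ...   | inj₂ a⊏v₁ =
    inj₂ (SwapAnc⇒⊏′-block₂ Block₂-v₁ (inj₁ (a⊏v₁ , λ (_ , v₂⊑v₁ , _) → proj₂ Block₂-v₁ v₂⊑v₁)))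

  ⊏⇒⊏′-below-w₂ : ∀ {a z} → w₂ ⊑ z → a ⊏ z → a ⊏′ z
  ⊏⇒⊏′-below-w₂ {a} w₂⊑z a⊏z with w₂ ⊑? a
  ... | yes w₂⊑a = ⊏⇒⊏′-within-w₂ w₂⊑a a⊏z
  ... | no  w₂⋢a with ⊑-linear (inj₂ a⊏z) w₂⊑z
  ...   | inj₂ w₂⊏a        = contradiction (inj₂ w₂⊏a) w₂⋢a
  ...   | inj₁ (inj₁ refl) = contradiction (inj₁ refl) w₂⋢a
  ...   | inj₁ (inj₂ a⊏w₂) =
    ⊏′-⊑′-trans (⊑′-⊏′-trans (⊑w₁⇒⊑′v₁ (⊏-parent par-w₂ a⊏w₂)) (here par′-w₂)) (w₂⊑⇒w₂⊑′ w₂⊑z)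

  SwapAnc⇒⊏′ : ∀ {a z} → SwapAnc a z → a ⊏′ z
  SwapAnc⇒⊏′ {z = z} anc with u₂ ⊑? z
  SwapAnc⇒⊏′ (inj₁ (a⊏z , _))            | no u₂⋢z = ⊏⇒⊏′-outside-u₂ u₂⋢z a⊏z
  SwapAnc⇒⊏′ (inj₂ ((u₂⊑z , _) , _))     | no u₂⋢z = contradiction u₂⊑z u₂⋢z
  SwapAnc⇒⊏′ {z = z} anc | yes u₂⊑z with v₂ ⊑? z
  ... | no v₂⋢z = SwapAnc⇒⊏′-block₂ (u₂⊑z , v₂⋢z) anc
  ... | yes v₂⊑z with w₂ ⊑? z
  ...   | no w₂⋢z = SwapAnc⇒⊏′-block₃ (v₂⊑z , w₂⋢z) anc
  SwapAnc⇒⊏′ (inj₁ (a⊏z , _))            | yes _ | yes _    | yes w₂⊑z = ⊏⇒⊏′-below-w₂ w₂⊑z a⊏z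
  SwapAnc⇒⊏′ (inj₂ ((_ , v₂⋢z) , _))     | yes _ | yes v₂⊑z | yes _    = contradiction v₂⊑z v₂⋢z

  Bag′ : V → V → Set
  Bag′ = InBag H par′

  module OffSwappedIntervals {z : V} (¬onP₂ : ¬ OnP₂ z) (¬onP₃ : ¬ OnP₃ z) where

    Block₂⇒subtree-avoids-v₂ : Block₂ z → ∀ {y} → z ⊑ y → ¬ v₂ ⊑ y
    Block₂⇒subtree-avoids-v₂ (u₂⊑z , v₂⋢z) z⊑y v₂⊑y with ⊑-linear z⊑y v₂⊑y
    ... | inj₂ v₂⊏z        = v₂⋢z (inj₂ v₂⊏z)
    ... | inj₁ (inj₁ refl) = v₂⋢z (inj₁ refl)
    ... | inj₁ (inj₂ z⊏v₂) = ¬onP₂ (u₂⊑z , ⊏-parent par-v₂ z⊏v₂)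

    Block₃⇒subtree-Block₃ : Block₃ z → ∀ {y} → z ⊑ y → Block₃ y
    Block₃⇒subtree-Block₃ (v₂⊑z , w₂⋢z) z⊑y = ⊑-trans v₂⊑z z⊑y , w₂⋢y
      where
      w₂⋢y : ¬ w₂ ⊑ _
      w₂⋢y w₂⊑y with ⊑-linear z⊑y w₂⊑y
      ... | inj₂ w₂⊏z        = w₂⋢z (inj₂ w₂⊏z)
      ... | inj₁ (inj₁ refl) = w₂⋢z (inj₁ refl)
      ... | inj₁ (inj₂ z⊏w₂) = ¬onP₃ (v₂⊑z , ⊏-parent par-w₂ z⊏w₂)

    Block₂⇒subtree-¬Adj-F-v₂ : Block₂ z → ∀ {y w} → z ⊑ y → v₂ ⊑ w → ¬ Adj H w y
    Block₂⇒subtree-¬Adj-F-v₂ block₂ z⊑y v₂⊑w adj with Adj⇒comparable adj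
    ... | inj₁ refl        = Block₂⇒subtree-avoids-v₂ block₂ z⊑y v₂⊑w
    ... | inj₂ (inj₁ w⊏y)  = Block₂⇒subtree-avoids-v₂ block₂ z⊑y (⊑-trans v₂⊑w (inj₂ w⊏y))
    ... | inj₂ (inj₂ y⊏w) with ⊑-linear (inj₂ y⊏w) v₂⊑w
    ...   | inj₂ v₂⊏y        = Block₂⇒subtree-avoids-v₂ block₂ z⊑y (inj₂ v₂⊏y)
    ...   | inj₁ (inj₁ refl) = Block₂⇒subtree-avoids-v₂ block₂ z⊑y (inj₁ refl)
    ...   | inj₁ (inj₂ y⊏v₂) = ¬onP₂ (proj₁ block₂ , ⊏-parent par-v₂ (⊑-⊏-trans z⊑y y⊏v₂))

    ⊑′⇔⊑ : ∀ {y} → z ⊑′ y ⇔ z ⊑ y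
    ⊑′⇔⊑ {y} = mk⇔ to from
      where
      to : z ⊑′ y → z ⊑ y
      to (inj₁ y≡z) = inj₁ y≡z
      to (inj₂ z⊏′y) with ⊏′⇒SwapAnc z⊏′y
      ... | inj₁ (z⊏y , _) = inj₂ z⊏y
      ... | inj₂ (_ , onP₃) = contradiction onP₃ ¬onP₃
      from : z ⊑ y → z ⊑′ y
      from (inj₁ y≡z) = inj₁ y≡z
      from (inj₂ z⊏y) = inj₂ (SwapAnc⇒⊏′ (inj₁ (z⊏y , λ (block₂ , v₂⊑y , _) →
        Block₂⇒subtree-avoids-v₂ block₂ (inj₂ z⊏y) v₂⊑y)))

    -- the only ancestry lost by the swap, from F_u₂ ∖ F_v₂ to F_v₂ ∖ F_w₂, carries no
    -- edge: the two blocks have different colours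
    Bag′⇔Bag : ∀ w → Bag′ z w ⇔ Bag z w
    Bag′⇔Bag w = mk⇔ to from
      where
      to : Bag′ z w → Bag z w
      to (inj₁ w≡z) = inj₁ w≡z
      to (inj₂ (w⊏′z , y , z⊑′y , adj)) with ⊏′⇒SwapAnc w⊏′z
      ... | inj₁ (w⊏z , _) = inj₂ (w⊏z , y , Equivalence.to ⊑′⇔⊑ z⊑′y , adj)
      ... | inj₂ (block₂ , v₂⊑w , _) =
        contradiction adj (Block₂⇒subtree-¬Adj-F-v₂ block₂ (Equivalence.to ⊑′⇔⊑ z⊑′y) v₂⊑w)
      from : Bag z w → Bag′ z w
      from (inj₁ w≡z) = inj₁ w≡z
      from (inj₂ (w⊏z , y , z⊑y , adj)) =
        inj₂ (SwapAnc⇒⊏′ (inj₁ (w⊏z , ¬both)) , y , Equivalence.from ⊑′⇔⊑ z⊑y , adj)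
        where
        ¬both : ¬ (Block₂ w × Block₃ z)
        ¬both (block₂ , block₃) =
          c₂-c₃-¬Adj (col-Block₂ block₂) (col-Block₃ (Block₃⇒subtree-Block₃ block₃ z⊑y)) adj

  module OnSwappedP₃ {z : V} (onP₃ : OnP₃ z) where

    block₃ : Block₃ z
    block₃ = proj₁ onP₃ , λ w₂⊑z → ⊑⇒¬⊐ (⊑-trans w₂⊑z (proj₂ onP₃)) w₁⊏w₂

    z⊏w₂ : z ⊏ w₂
    z⊏w₂ = ⊑-⊏-trans (proj₂ onP₃) w₁⊏w₂

    z-onSpine : OnSpine z
    z-onSpine = ⊑-trans (proj₁ v₂-onSpine) (proj₁ onP₃) , ⊑-trans (inj₂ z⊏w₂) w₂⊑p

    col-z : col z ≡ c₃
    col-z = col-P₃ (proj₁ onP₃) (proj₂ onP₃)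

    u₁⊏z : u₁ ⊏ z
    u₁⊏z = ⊏-trans u₁⊏u₂ (⊏-⊑-trans u₂⊏v₂ (proj₁ onP₃))

    ⊏′z⇔ : ∀ {w} → w ⊏′ z ⇔ (w ⊏ z × ¬ Block₂ w)
    ⊏′z⇔ {w} = mk⇔ to from
      where
      to : w ⊏′ z → w ⊏ z × ¬ Block₂ w
      to w⊏′z with ⊏′⇒SwapAnc w⊏′z
      ... | inj₁ (w⊏z , ¬both)       = w⊏z , λ block₂ → ¬both (block₂ , block₃)
      ... | inj₂ ((_ , v₂⋢z) , _)    = contradiction (proj₁ block₃) v₂⋢z
      from : w ⊏ z × ¬ Block₂ w → w ⊏′ z
      from (w⊏z , ¬block₂) = SwapAnc⇒⊏′ (inj₁ (w⊏z , ¬block₂ ∘ proj₁))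

    z⊑′⇔ : ∀ {y} → z ⊑′ y ⇔ (z ⊑ y ⊎ Block₂ y)
    z⊑′⇔ {y} = mk⇔ to from
      where
      to : z ⊑′ y → z ⊑ y ⊎ Block₂ y
      to (inj₁ y≡z) = inj₁ (inj₁ y≡z)
      to (inj₂ z⊏′y) with ⊏′⇒SwapAnc z⊏′y
      ... | inj₁ (z⊏y , _) = inj₁ (inj₂ z⊏y)
      ... | inj₂ (block₂ , _) = inj₂ block₂
      from : z ⊑ y ⊎ Block₂ y → z ⊑′ y
      from (inj₁ (inj₁ y≡z)) = inj₁ y≡z
      from (inj₁ (inj₂ z⊏y)) = inj₂ (SwapAnc⇒⊏′ (inj₁ (z⊏y , λ ((_ , v₂⋢z) , _) → v₂⋢z (proj₁ block₃))))
      from (inj₂ block₂)     = inj₂ (SwapAnc⇒⊏′ (inj₂ (block₂ , onP₃)))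

    ancestor-above-u₂ : ∀ {w} → w ⊏ z → ¬ Block₂ w → col w ≢ c₃ → w ⊏ u₂
    ancestor-above-u₂ {w} w⊏z ¬block₂ w≢c₃ with ⊑-linear (inj₂ w⊏z) (⊑-trans (inj₂ u₂⊏v₂) (proj₁ onP₃))
    ... | inj₁ (inj₂ w⊏u₂) = w⊏u₂
    ... | inj₁ (inj₁ refl) = contradiction Block₂-u₂ ¬block₂
    ... | inj₂ u₂⊏w with v₂ ⊑? w
    ...   | no  v₂⋢w = contradiction (inj₂ u₂⊏w , v₂⋢w) ¬block₂
    ...   | yes v₂⊑w = contradiction (col-block₃ v₂⊑w λ w₂⊑w → proj₂ block₃ (⊑-trans w₂⊑w (inj₂ w⊏z))) w≢c₃

    Bag⇒Bag′-¬c₂ : ∀ {w} → col w ≢ c₂ → Bag z w → Bag′ z w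
    Bag⇒Bag′-¬c₂ _    (inj₁ w≡z) = inj₁ w≡z
    Bag⇒Bag′-¬c₂ w≢c₂ (inj₂ (w⊏z , y , z⊑y , adj)) =
      inj₂ (Equivalence.from ⊏′z⇔ (w⊏z , w≢c₂ ∘ col-Block₂) , y , Equivalence.from z⊑′⇔ (inj₁ z⊑y) , adj)

    Bag′⇒Bag-c₃ : ∀ {w} → col w ≡ c₃ → Bag′ z w → Bag z w
    Bag′⇒Bag-c₃ _ (inj₁ w≡z) = inj₁ w≡z
    Bag′⇒Bag-c₃ w≡c₃ (inj₂ (w⊏′z , y , z⊑′y , adj)) with Equivalence.to z⊑′⇔ z⊑′y
    ... | inj₁ z⊑y    = inj₂ (proj₁ (Equivalence.to ⊏′z⇔ w⊏′z) , y , z⊑y , adj)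
    ... | inj₂ block₂ = contradiction adj (c₃-c₂-¬Adj w≡c₃ (col-Block₂ block₂))

    -- an X-vertex adjacent to the block F_u₂ ∖ F_v₂, now below z, was already in
    -- the bag of u₂, hence by homogeneity in the X-ball of z
    Bag′⇒Bag-X : ∀ {w} → col w ≡ xcol → Bag′ z w → Bag z w
    Bag′⇒Bag-X _ (inj₁ w≡z) = inj₁ w≡z
    Bag′⇒Bag-X {w} w≡x (inj₂ (w⊏′z , y , z⊑′y , adj))
      with Equivalence.to ⊏′z⇔ w⊏′z | Equivalence.to z⊑′⇔ z⊑′y
    ... | w⊏z , _       | inj₁ z⊑y    = inj₂ (w⊏z , y , z⊑y , adj)
    ... | w⊏z , ¬block₂ | inj₂ block₂ =
      XBall⇒Bag (XBall-transfer u₂-onSpine z-onSpine (X⇒XBall bag-u₂ w≡x))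
      where
      bag-u₂ : Bag u₂ w
      bag-u₂ = inj₂ (ancestor-above-u₂ w⊏z ¬block₂ (λ w≡c₃ → ≡c₃⇒≢xcol w≡c₃ w≡x) , y , proj₁ block₂ , adj)

    Bag′⇒Bag-¬c₂ : ∀ {w} → col w ≢ c₂ → Bag′ z w → Bag z w
    Bag′⇒Bag-¬c₂ {w} w≢c₂ b with col w ≟ᶜ xcol
    ... | yes w≡x = Bag′⇒Bag-X w≡x b
    ... | no  w≢x = Bag′⇒Bag-c₃ (trans (≢⇒≡opposite c₂≢xcol w≢x (w≢c₂ ∘ sym)) (sym c₃≡opposite-c₂)) b

    Bag′⇒Bag-u₁-c₂ : ∀ {w} → col w ≡ c₂ → Bag′ z w → Bag u₁ w
    Bag′⇒Bag-u₁-c₂ w≡c₂ (inj₁ refl) = contradiction (trans (sym w≡c₂) col-z) c₂≢c₃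
    Bag′⇒Bag-u₁-c₂ {w} w≡c₂ (inj₂ (w⊏′z , y , z⊑′y , adj)) = inj₂ (w⊏u₁ , y , u₁⊑y , adj)
      where
      w⊏u₂ : w ⊏ u₂
      w⊏u₂ = uncurry ancestor-above-u₂ (Equivalence.to ⊏′z⇔ w⊏′z) (λ w≡c₃ → c₂≢c₃ (trans (sym w≡c₂) w≡c₃))
      w⊏u₁ : w ⊏ u₁
      w⊏u₁ with ⊏-parent par-u₂ w⊏u₂
      ... | inj₁ refl = contradiction (trans (sym w≡c₂) col-u₁) c₂≢c₃
      ... | inj₂ w⊏u₁ = w⊏u₁
      u₁⊑y : u₁ ⊑ y
      u₁⊑y with Equivalence.to z⊑′⇔ z⊑′y
      ... | inj₁ z⊑y    = ⊑-trans (inj₂ u₁⊏z) z⊑y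
      ... | inj₂ block₂ = ⊑-trans (inj₂ u₁⊏u₂) (proj₁ block₂)

    Bag-u₁⇒Bag′-c₂ : ∀ {w} → col w ≡ c₂ → Bag u₁ w → Bag′ z w
    Bag-u₁⇒Bag′-c₂ w≡c₂ (inj₁ refl) = contradiction (trans (sym w≡c₂) col-u₁) c₂≢c₃
    Bag-u₁⇒Bag′-c₂ {w} w≡c₂ (inj₂ (w⊏u₁ , y , u₁⊑y , adj)) =
      inj₂ (Equivalence.from ⊏′z⇔ (⊏-trans w⊏u₁ u₁⊏z , λ (u₂⊑w , _) → ⊑⇒¬⊐ u₂⊑w (⊏-trans w⊏u₁ u₁⊏u₂)) ,
            y , Equivalence.from z⊑′⇔ y-below , adj)
      where
      y-below : z ⊑ y ⊎ Block₂ y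
      y-below with u₂ ⊑? y
      ... | no u₂⋢y = contradiction adj (c₂-c₃-¬Adj w≡c₂ (col-block₁ (⊑-trans h₁⊑u₁ u₁⊑y) u₂⋢y))
      ... | yes u₂⊑y with v₂ ⊑? y
      ...   | no v₂⋢y = inj₂ (u₂⊑y , v₂⋢y)
      ...   | yes v₂⊑y with w₂ ⊑? y
      ...     | no w₂⋢y = contradiction adj (c₂-c₃-¬Adj w≡c₂ (col-block₃ v₂⊑y w₂⋢y))
      ...     | yes w₂⊑y = inj₁ (⊑-trans (inj₂ z⊏w₂) w₂⊑y)

    XBall⇒Bag′ : ∀ {w} → XBall z w → Bag′ z w
    XBall⇒Bag′ {w} xball with col w ≟ᶜ c₂
    ... | yes w≡c₂ = Bag-u₁⇒Bag′-c₂ w≡c₂ (XBall⇒Bag (XBall-transfer z-onSpine u₁-onSpine xball))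
    ... | no  w≢c₂ = Bag⇒Bag′-¬c₂ w≢c₂ (XBall⇒Bag xball)

    Bag′⇔Core⊎FBall-u₁ : ∀ w → Bag′ z w ⇔ (Core z w ⊎ FBall u₁ w)
    Bag′⇔Core⊎FBall-u₁ w = mk⇔ to from
      where
      opposite-z : opposite (col z) ≡ c₂
      opposite-z = trans (cong opposite col-z) (sym c₂≡opposite-c₃)
      to : Bag′ z w → Core z w ⊎ FBall u₁ w
      to b with col w ≟ᶜ c₂
      ... | yes w≡c₂ with XBall? u₁ w
      ...   | yes xball = inj₁ (XBall⇒Bag xball-z , inj₂ xball-z)
        where
        xball-z : XBall z w
        xball-z = XBall-transfer u₁-onSpine z-onSpine xball
      ...   | no ¬xball =
        inj₂ (Bag′⇒Bag-u₁-c₂ w≡c₂ b , Equivalence.from NoX⇔¬XBall ¬xball , OtherColour-c₃-c₂ col-u₁ w≡c₂)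
      to b | no w≢c₂ = inj₁ (Bag′⇒Bag-¬c₂ w≢c₂ b , inj₁ λ w≡opp → w≢c₂ (trans w≡opp opposite-z))
      from : Core z w ⊎ FBall u₁ w → Bag′ z w
      from (inj₁ (b , inj₁ w≢opp)) = Bag⇒Bag′-¬c₂ (λ w≡c₂ → w≢opp (trans w≡c₂ (sym opposite-z))) b
      from (inj₁ (b , inj₂ xball)) = XBall⇒Bag′ xball
      from (inj₂ fball) =
        Bag-u₁⇒Bag′-c₂ (trans (FBall⇒col fball) (trans (cong opposite col-u₁) (sym c₂≡opposite-c₃))) (proj₁ fball)

  module OnSwappedP₂ {z : V} (onP₂ : OnP₂ z) where

    block₂ : Block₂ z
    block₂ = proj₁ onP₂ , λ v₂⊑z → ⊑⇒¬⊐ (⊑-trans v₂⊑z (proj₂ onP₂)) v₁⊏v₂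

    z⊏v₂ : z ⊏ v₂
    z⊏v₂ = ⊑-⊏-trans (proj₂ onP₂) v₁⊏v₂

    z⊏w₂ : z ⊏ w₂
    z⊏w₂ = ⊏-trans z⊏v₂ v₂⊏w₂

    z-onSpine : OnSpine z
    z-onSpine = ⊑-trans (proj₁ u₂-onSpine) (proj₁ onP₂) , ⊑-trans (inj₂ z⊏w₂) w₂⊑p

    col-z : col z ≡ c₂
    col-z = col-P₂ (proj₁ onP₂) (proj₂ onP₂)

    ⊏′z⇔ : ∀ {w} → w ⊏′ z ⇔ (w ⊏ z ⊎ OnP₃ w)
    ⊏′z⇔ {w} = mk⇔ to from
      where
      to : w ⊏′ z → w ⊏ z ⊎ OnP₃ w
      to w⊏′z with ⊏′⇒SwapAnc w⊏′z
      ... | inj₁ (w⊏z , _)  = inj₁ w⊏z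
      ... | inj₂ (_ , onP₃) = inj₂ onP₃
      from : w ⊏ z ⊎ OnP₃ w → w ⊏′ z
      from (inj₁ w⊏z)  = SwapAnc⇒⊏′ (inj₁ (w⊏z , λ (_ , v₂⊑z , _) → proj₂ block₂ v₂⊑z))
      from (inj₂ onP₃) = SwapAnc⇒⊏′ (inj₂ (block₂ , onP₃))

    z⊑′⇔ : ∀ {y} → z ⊑′ y ⇔ (z ⊑ y × ¬ Block₃ y)
    z⊑′⇔ {y} = mk⇔ to from
      where
      to : z ⊑′ y → z ⊑ y × ¬ Block₃ y
      to (inj₁ refl) = inj₁ refl , λ (v₂⊑z , _) → proj₂ block₂ v₂⊑z
      to (inj₂ z⊏′y) with ⊏′⇒SwapAnc z⊏′y
      ... | inj₁ (z⊏y , ¬both)        = inj₂ z⊏y , λ block₃ → ¬both (block₂ , block₃)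
      ... | inj₂ (_ , v₂⊑z , _)       = contradiction v₂⊑z (proj₂ block₂)
      from : z ⊑ y × ¬ Block₃ y → z ⊑′ y
      from (inj₁ y≡z , _)      = inj₁ y≡z
      from (inj₂ z⊏y , ¬block₃) = inj₂ (SwapAnc⇒⊏′ (inj₁ (z⊏y , ¬block₃ ∘ proj₂)))

    Bag′⇒Bag-¬c₃ : ∀ {w} → col w ≢ c₃ → Bag′ z w → Bag z w
    Bag′⇒Bag-¬c₃ _ (inj₁ w≡z) = inj₁ w≡z
    Bag′⇒Bag-¬c₃ w≢c₃ (inj₂ (w⊏′z , y , z⊑′y , adj)) with Equivalence.to ⊏′z⇔ w⊏′z
    ... | inj₁ w⊏z  = inj₂ (w⊏z , y , proj₁ (Equivalence.to z⊑′⇔ z⊑′y) , adj)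
    ... | inj₂ onP₃ = contradiction (col-P₃ (proj₁ onP₃) (proj₂ onP₃)) w≢c₃

    Bag⇒Bag′-c₂ : ∀ {w} → col w ≡ c₂ → Bag z w → Bag′ z w
    Bag⇒Bag′-c₂ _ (inj₁ w≡z) = inj₁ w≡z
    Bag⇒Bag′-c₂ w≡c₂ (inj₂ (w⊏z , y , z⊑y , adj)) =
      inj₂ (Equivalence.from ⊏′z⇔ (inj₁ w⊏z) , y ,
            Equivalence.from z⊑′⇔ (z⊑y , λ block₃ → c₂-c₃-¬Adj w≡c₂ (col-Block₃ block₃) adj) , adj)

    -- an X-vertex of the bag of z is, by homogeneity, in the bag of w₂ and hence adjacent to F_w₂
    Bag⇒Bag′-X : ∀ {w} → col w ≡ xcol → Bag z w → Bag′ z w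
    Bag⇒Bag′-X _ (inj₁ w≡z) = inj₁ w≡z
    Bag⇒Bag′-X {w} w≡x b@(inj₂ (w⊏z , _)) with XBall⇒Bag (XBall-transfer z-onSpine w₂-onSpine (X⇒XBall b w≡x))
    ... | inj₁ refl = contradiction (trans (sym col-w₂) w≡x) c₂≢xcol
    ... | inj₂ (_ , y , w₂⊑y , adj) =
      inj₂ (Equivalence.from ⊏′z⇔ (inj₁ w⊏z) , y ,
            Equivalence.from z⊑′⇔ (⊑-trans (inj₂ z⊏w₂) w₂⊑y , λ (_ , w₂⋢y) → w₂⋢y w₂⊑y) , adj)

    Bag⇒Bag′-¬c₃ : ∀ {w} → col w ≢ c₃ → Bag z w → Bag′ z w
    Bag⇒Bag′-¬c₃ {w} w≢c₃ b with col w ≟ᶜ xcol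
    ... | yes w≡x = Bag⇒Bag′-X w≡x b
    ... | no  w≢x = Bag⇒Bag′-c₂ (trans (≢⇒≡opposite c₃≢xcol w≢x (w≢c₃ ∘ sym)) (sym c₂≡opposite-c₃)) b

    Bag′⇒Bag-w₂-c₃ : ∀ {w} → col w ≡ c₃ → Bag′ z w → Bag w₂ w
    Bag′⇒Bag-w₂-c₃ w≡c₃ (inj₁ refl) = contradiction (trans (sym col-z) w≡c₃) c₂≢c₃
    Bag′⇒Bag-w₂-c₃ {w} w≡c₃ (inj₂ (w⊏′z , y , z⊑′y , adj)) = inj₂ (w⊏w₂ , y , w₂⊑y , adj)
      where
      w⊏w₂ : w ⊏ w₂
      w⊏w₂ with Equivalence.to ⊏′z⇔ w⊏′z
      ... | inj₁ w⊏z  = ⊏-trans w⊏z z⊏w₂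
      ... | inj₂ onP₃ = ⊑-⊏-trans (proj₂ onP₃) w₁⊏w₂
      w₂⊑y : w₂ ⊑ y
      w₂⊑y with Equivalence.to z⊑′⇔ z⊑′y
      ... | z⊑y , ¬block₃ with v₂ ⊑? y
      ...   | no  v₂⋢y = contradiction adj (c₃-c₂-¬Adj w≡c₃ (col-block₂ (⊑-trans (proj₁ onP₂) z⊑y) v₂⋢y))
      ...   | yes v₂⊑y with w₂ ⊑? y
      ...     | no  w₂⋢y = contradiction (v₂⊑y , w₂⋢y) ¬block₃
      ...     | yes w₂⊑y = w₂⊑y

    Bag-w₂⇒Bag′-c₃ : ∀ {w} → col w ≡ c₃ → Bag w₂ w → Bag′ z w
    Bag-w₂⇒Bag′-c₃ w≡c₃ (inj₁ refl) = contradiction (trans (sym col-w₂) w≡c₃) c₂≢c₃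
    Bag-w₂⇒Bag′-c₃ {w} w≡c₃ (inj₂ (w⊏w₂ , y , w₂⊑y , adj)) =
      inj₂ (Equivalence.from ⊏′z⇔ w-above , y ,
            Equivalence.from z⊑′⇔ (⊑-trans (inj₂ z⊏w₂) w₂⊑y , λ (_ , w₂⋢y) → w₂⋢y w₂⊑y) , adj)
      where
      w⊑w₁ : w ⊑ w₁
      w⊑w₁ = ⊏-parent par-w₂ w⊏w₂
      w-above : w ⊏ z ⊎ OnP₃ w
      w-above with ⊑-linear w⊑w₁ v₂⊑w₁
      ... | inj₂ v₂⊏w        = inj₂ (inj₂ v₂⊏w , w⊑w₁)
      ... | inj₁ (inj₁ refl) = inj₂ OnP₃-v₂
      ... | inj₁ (inj₂ w⊏v₂) with ⊑-linear (⊏-parent par-v₂ w⊏v₂) (proj₂ onP₂)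
      ...   | inj₂ z⊏w        =
        contradiction (trans (sym (col-P₂ (⊑-trans (proj₁ onP₂) (inj₂ z⊏w)) (⊏-parent par-v₂ w⊏v₂))) w≡c₃) c₂≢c₃
      ...   | inj₁ (inj₁ refl) = contradiction (trans (sym col-z) w≡c₃) c₂≢c₃
      ...   | inj₁ (inj₂ w⊏z)  = inj₁ w⊏z

    XBall⇒Bag′ : ∀ {w} → XBall z w → Bag′ z w
    XBall⇒Bag′ {w} xball with col w ≟ᶜ c₃
    ... | yes w≡c₃ = Bag-w₂⇒Bag′-c₃ w≡c₃ (XBall⇒Bag (XBall-transfer z-onSpine w₂-onSpine xball))
    ... | no  w≢c₃ = Bag⇒Bag′-¬c₃ w≢c₃ (XBall⇒Bag xball)

    Bag′⇔Core⊎FBall-w₂ : ∀ w → Bag′ z w ⇔ (Core z w ⊎ FBall w₂ w)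
    Bag′⇔Core⊎FBall-w₂ w = mk⇔ to from
      where
      opposite-z : opposite (col z) ≡ c₃
      opposite-z = trans (cong opposite col-z) (sym c₃≡opposite-c₂)
      to : Bag′ z w → Core z w ⊎ FBall w₂ w
      to b with col w ≟ᶜ c₃
      ... | yes w≡c₃ with XBall? w₂ w
      ...   | yes xball = inj₁ (XBall⇒Bag xball-z , inj₂ xball-z)
        where
        xball-z : XBall z w
        xball-z = XBall-transfer w₂-onSpine z-onSpine xball
      ...   | no ¬xball =
        inj₂ (Bag′⇒Bag-w₂-c₃ w≡c₃ b , Equivalence.from NoX⇔¬XBall ¬xball , OtherColour-c₂-c₃ col-w₂ w≡c₃)
      to b | no w≢c₃ = inj₁ (Bag′⇒Bag-¬c₃ w≢c₃ b , inj₁ λ w≡opp → w≢c₃ (trans w≡opp opposite-z))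
      from : Core z w ⊎ FBall w₂ w → Bag′ z w
      from (inj₁ (b , inj₁ w≢opp)) = Bag⇒Bag′-¬c₃ (λ w≡c₃ → w≢opp (trans w≡c₃ (sym opposite-z))) b
      from (inj₁ (b , inj₂ xball)) = XBall⇒Bag′ xball
      from (inj₂ fball) =
        Bag-w₂⇒Bag′-c₃ (trans (FBall⇒col fball) (trans (cong opposite col-w₂) (sym c₃≡opposite-c₂))) (proj₁ fball)

  module Width {f : WidthFn} (M : Manageable f) where

    open Additivity M H

    BagSet CoreSet FBallSet : V → Subset (n H)
    BagSet u   = subsetOf (Bag? u)
    CoreSet u  = subsetOf (Core? u)
    FBallSet u = subsetOf (FBall? u)

    f-Core⊎FBall : ∀ {z z′} (S : Subset (n H)) → col z ≢ xcol → col z ≡ col z′ →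
                   (∀ {w} → XBall z w → XBall z′ w) → S ≐ (λ w → Core z w ⊎ FBall z′ w) →
                   f H S ≡ f H (CoreSet z) +ℚ f H (FBallSet z′)
    f-Core⊎FBall {z} {z′} S z≢x z≡z′ xball⊆ S≐ = ≐-additive S (CoreSet z) (FBallSet z′)
      (λ w → ⇔-trans (S≐ w) (⇔-sym (core≐ w) ⊎-⇔ ⇔-sym (fball≐ w)))
      (λ w w∈core w∈fball →
         Core-FBall-disjoint z≢x z≡z′ xball⊆ (Equivalence.to (core≐ w) w∈core) (Equivalence.to (fball≐ w) w∈fball))
      (All.tabulate λ e∈edges a b a∈e a∈core b∈e b∈fball →
         Core-FBall-nonadjacent z≢x z≡z′ xball⊆ (Any.map (λ { refl → a∈e , b∈e }) e∈edges)
                                (Equivalence.to (core≐ a) a∈core) (Equivalence.to (fball≐ b) b∈fball))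
      where
      core≐ : CoreSet z ≐ Core z
      core≐ = subsetOf≐ (Core? z)
      fball≐ : FBallSet z′ ≐ FBall z′
      fball≐ = subsetOf≐ (FBall? z′)

    width-≤ : ∀ {z z′} (B′ : Subset (n H)) → col z ≢ xcol → col z ≡ col z′ →
              (∀ {w} → XBall z w → XBall z′ w) → B′ ≐ (λ w → Core z w ⊎ FBall z′ w) →
              f H (FBallSet z′) ≤ f H (FBallSet z) → f H B′ ≤ f H (BagSet z)
    width-≤ {z} {z′} B′ z≢x z≡z′ xball⊆ B′≐ fball≤ = begin
      f H B′                                ≡⟨ f-Core⊎FBall B′ z≢x z≡z′ xball⊆ B′≐ ⟩
      f H (CoreSet z) +ℚ f H (FBallSet z′)  ≤⟨ ℚ.+-monoʳ-≤ (f H (CoreSet z)) fball≤ ⟩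
      f H (CoreSet z) +ℚ f H (FBallSet z)   ≡⟨ f-Core⊎FBall (BagSet z) z≢x refl id bag≐ ⟨
      f H (BagSet z)                        ∎
      where
      open ℚ.≤-Reasoning
      bag≐ : BagSet z ≐ (λ w → Core z w ⊎ FBall z w)
      bag≐ w = ⇔-trans (subsetOf≐ (Bag? z) w) (Bag⇔Core⊎FBall z≢x w)

    FW-FBallSet : ∀ {s} (P : List⁺ V) → (∀ w → FBall s w ⇔ FBall (head⁺ P) w) → FW f H col par P (f H (FBallSet s))
    FW-FBallSet {s} P fball⇔ = FBallSet s , (λ w → ⇔-trans (subsetOf≐ (FBall? s) w) (fball⇔ w)) , refl

    swap-neutral : (∀ r₁ r₃ → FW f H col par P₁ r₁ → FW f H col par P₃ r₃ → r₁ ≤ r₃) →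
                   (∀ r₂ r₄ → FW f H col par P₂ r₂ → FW f H col par P₄ r₄ → r₄ ≤ r₂) →
                   WidthLe f H par′ par
    swap-neutral mutable₁₃ mutable₂₄ z B′ B′≐ with (u₂ ⊑? z ×-dec z ⊑? v₁) | (v₂ ⊑? z ×-dec z ⊑? w₁)
    ... | no ¬onP₂ | no ¬onP₃ =
      z , B′ , (λ w → ⇔-trans (B′≐ w) (OffSwappedIntervals.Bag′⇔Bag ¬onP₂ ¬onP₃ w)) , ℚ.≤-refl
    ... | _ | yes onP₃ =
      z , BagSet z , subsetOf≐ (Bag? z) ,
      width-≤ B′ (onSpine⇒¬X z-onSpine) (trans col-z (sym col-u₁)) (XBall-transfer z-onSpine u₁-onSpine)
              (λ w → ⇔-trans (B′≐ w) (Bag′⇔Core⊎FBall-u₁ w))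
              (mutable₁₃ _ _ (FW-FBallSet P₁ FBall-P₁) (FW-FBallSet P₃ (FBall-P₃ onP₃)))
      where open OnSwappedP₃ onP₃
    ... | yes onP₂ | no _ =
      z , BagSet z , subsetOf≐ (Bag? z) ,
      width-≤ B′ (onSpine⇒¬X z-onSpine) (trans col-z (sym col-w₂)) (XBall-transfer z-onSpine w₂-onSpine)
              (λ w → ⇔-trans (B′≐ w) (Bag′⇔Core⊎FBall-w₂ w))
              (mutable₂₄ _ _ (FW-FBallSet P₂ (FBall-P₂ onP₂)) (FW-FBallSet P₄ λ _ → ⇔-refl))
      where open OnSwappedP₂ onP₂

lemma40 : (f : WidthFn) → Manageable f →
          (H : Hypergraph) (col : Fin′ H → Colour) → NoRedBlueEdge H col →
          (par : Parent (n H)) → EliminationForest H par → Reduced H par →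
          (U₀ : Subset (n H)) (spine : List (Fin′ H)) →
          ContextFactor par U₀ spine →
          (∀ v → v ∈ U₀ → col v ≢ xcol) →
          XHomogenous H col par spine →
          (Ps A C : List (List⁺ (Fin′ H))) → ColourIntervals col spine Ps →
          (P₁ P₂ P₃ P₄ : List⁺ (Fin′ H)) →
          Ps ≡ A ++ (P₁ ∷ P₂ ∷ P₃ ∷ P₄ ∷ C) →
          (∀ r₁ r₃ → FW f H col par P₁ r₁ → FW f H col par P₃ r₃ → r₁ ≤ r₃) →
          (∀ r₂ r₄ → FW f H col par P₂ r₂ → FW f H col par P₄ r₄ → r₄ ≤ r₂) →
          WidthLe f H (swapParent par P₁ P₂ P₃ P₄) par
lemma40 f M H col noRedBlue par EF reduced U₀ spine CF U₀-noX XH Ps A C CI P₁ P₂ P₃ P₄ Ps≡ =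
  Setting.Width.swap-neutral H col noRedBlue par EF reduced U₀ spine CF U₀-noX XH Ps A C CI P₁ P₂ P₃ P₄ Ps≡ M
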